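{- Let $n\ge 4$ and let $\mathcal{D}$ be a single-crossing domain of linear orders on an $n$-element set $A$ that is a maximal Condorcet domain. Then $\mathcal{D}$ is not single-peaked on a circle.
   Context: A domain $\mathcal{D}$ of linear orders on $A$ is single-crossing if its orders can be listed as $v_1,\ldots,v_m$ so that for every pair of alternatives $a,b$ the set of indices $i$ with $a\succ_{v_i}b$ is an initial or a final segment of $\{1,\ldots,m\}$. A Condorcet domain is a set $\mathcal{D}$ of linear orders on $A$ such that for every finite profile of voters with preferences from $\mathcal{D}$ the pairwise majority relation is acyclic; it is maximal if no Condorcet domain on $A$ properly contains it. A domain is single-peaked on a circle if the alternatives can be placed on a circle $a_1\triangleleft a_2\triangleleft\cdots\triangleleft a_n\triangleleft a_1$ so that for every order $v$ of the domain and every alternative $a$, the upper contour set $\{b\in A: b\succ_v a\}$ is a contiguous arc of the circle. -}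

module Defs where

open import Data.Nat using (ℕ; _+_; _≤_; _<_)
open import Data.Fin as Fin using (Fin; toℕ)
open import Data.Fin.Properties using (any?; _≟_)
open import Data.Vec using (Vec; lookup)
open import Data.List using (List; length; filter)
import Data.List as List
open import Data.List.Membership.Propositional using (_∈_)
open import Data.List.Relation.Unary.All using (All)
open import Data.List.Relation.Unary.Unique.Propositional using (Unique)
open import Data.Product using (Σ; ∃; ∃-syntax; _×_; _,_)
open import Data.Product.Properties using ()
open import Data.Sum using (_⊎_)
open import Relation.Nullary using (¬_; Dec)
open import Relation.Nullary.Decidable using (_×-dec_)
open import Relation.Binary.PropositionalEquality using (_≡_)
open import Relation.Binary.Construct.Closure.Transitive using (TransClosure)
open import Function.Bundles using (_⇔_)

-- Alternatives: A = Fin n.  A linear order on A is represented by the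
-- vector listing the alternatives from best (index 0) to worst, with no
-- repetitions (so it is a bijection Fin n → Fin n).
Order : ℕ → Set
Order n = Vec (Fin n) n

IsLinOrder : ∀ {n} → Order n → Set
IsLinOrder v = ∀ i j → lookup v i ≡ lookup v j → i ≡ j

Prefers : ∀ {n} → Order n → Fin n → Fin n → Set
Prefers {n} v a b = ∃[ i ] ∃[ j ] (i Fin.< j × lookup v i ≡ a × lookup v j ≡ b)

prefers? : ∀ {n} (v : Order n) a b → Dec (Prefers v a b)
prefers? v a b = any? λ i → any? λ j →
  (i Fin.<? j) ×-dec ((lookup v i ≟ a) ×-dec (lookup v j ≟ b))

Domain : ℕ → Set
Domain n = List (Order n)

count : ∀ {n} → List (Order n) → Fin n → Fin n → ℕ
count P a b = length (filter (λ v → prefers? v a b) P)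

Majority : ∀ {n} → List (Order n) → Fin n → Fin n → Set
Majority P a b = count P b a < count P a b

Acyclic : ∀ {n} → (Fin n → Fin n → Set) → Set
Acyclic R = ∀ a → ¬ TransClosure R a a

-- every finite profile of voters with preferences from D has acyclic
-- majority relation (profiles are finite lists, repetitions allowed)
IsCondorcet : ∀ {n} → Domain n → Set
IsCondorcet {n} D = All IsLinOrder D ×
  ((P : List (Order n)) → All (_∈ D) P → Acyclic (Majority P))

IsMaximalCondorcet : ∀ {n} → Domain n → Set
IsMaximalCondorcet {n} D = IsCondorcet D ×
  ((D' : Domain n) → IsCondorcet D' → (∀ v → v ∈ D → v ∈ D') →
     ∀ v → v ∈ D' → v ∈ D)

IsInitialOrFinal : ∀ {m} → (Fin m → Set) → Set
IsInitialOrFinal {m} S = ∃[ k ] (k ≤ m ×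
  ((∀ i → S i ⇔ (toℕ i < k)) ⊎ (∀ i → S i ⇔ (k ≤ toℕ i))))

IsSingleCrossing : ∀ {n} → Domain n → Set
IsSingleCrossing {n} D = ∃[ L ] (Unique L × (∀ v → v ∈ L ⇔ v ∈ D) ×
  (∀ a b → IsInitialOrFinal (λ (i : Fin (length L)) →
      Prefers (List.lookup L i) a b)))

-- A circle arrangement is a vector c (injective) listing alternatives
-- around the circle: c₀ ◁ c₁ ◁ ⋯ ◁ c_{n-1} ◁ c₀.
-- S is an arc iff S = {c_{(s+i) mod n} | i < ℓ} for some s, ℓ ≤ n
-- (ℓ = 0 gives the empty arc).  Since s < n and i < n, (s+i) mod n is the
-- j with j = s+i or j + n = s+i.
IsArc : ∀ {n} → Order n → (Fin n → Set) → Set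
IsArc {n} c S = ∃[ s ] ∃[ ℓ ] (ℓ ≤ n × (∀ b → S b ⇔
  (∃[ i ] ∃[ j ] (i < ℓ × (toℕ j ≡ toℕ {n} s + i ⊎ toℕ j + n ≡ toℕ s + i)
                  × b ≡ lookup c j))))

IsSinglePeakedOnCircle : ∀ {n} → Domain n → Set
IsSinglePeakedOnCircle {n} D = ∃[ c ] (IsLinOrder c ×
  (∀ v → v ∈ D → ∀ a → IsArc c (λ b → Prefers v b a)))

{-# OPTIONS --safe #-}
-- The order of a median voter contains the majority relation
-- of every profile on a chain, so every chain is a Condorcet domain, and a maximal domain admits no
-- longer chain through it: f (m − 1) reverses f 0 and consecutive orders differ by one adjacent
-- transposition. Consecutive transpositions also overlap, since otherwise the fourth corner of the
-- square they span could be added to the domain. As n ≥ 4, neither of the two best alternatives of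
-- f 0 is among the two best of f (m − 1), so the top pair is swapped at an interior step s, and
-- overlapping forces the transpositions of positions 1 and 2 just before and after it.
-- Single-peakedness on a circle makes the two best alternatives of each order neighbours on the
-- circle, so f (s − 1), f s and f (s + 2) exhibit three pairwise neighbouring alternatives, which is
-- impossible on a circle of n ≥ 4 places.
module Submission where

open import Defs
open import Data.Nat
  using (ℕ; zero; suc; pred; _+_; _*_; _∸_; _<_; _≤_; z≤n; s≤s; z<s; s<s; _<?_; _≤?_; _≟_; NonZero; >-nonZero)
import Data.Nat.Properties as ℕₚ
open import Data.Nat.Solver using (module +-*-Solver)
open import Data.Fin.Base as Fin using (Fin; toℕ; fromℕ<)
open import Data.Fin.Patterns using (0F; 1F; 2F; 3F)
import Data.Fin.Properties as Finₚ
open import Data.Fin.Permutation.Components using (transpose)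
open import Data.Vec.Base using (lookup; tabulate; allFin)
import Data.Vec.Properties as Vecₚ
open import Data.List.Base as List using (List; []; _∷_; _++_; length; filter; map; replicate)
import Data.List.Properties as Listₚ
open import Data.List.Relation.Unary.All as All using (All; []; _∷_)
import Data.List.Relation.Unary.All.Properties as AllP
open import Data.List.Relation.Unary.Any as Any using (Any; here; there)
open import Data.List.Membership.Propositional using (_∈_)
open import Data.List.Relation.Unary.Unique.Propositional using (Unique)
open import Data.List.Relation.Unary.AllPairs using ([]; _∷_)
open import Data.Product using (∃-syntax; _×_; _,_; proj₁; proj₂)
open import Data.Sum using (_⊎_; inj₁; inj₂; [_,_])
open import Data.Empty using (⊥; ⊥-elim)
open import Function.Base using (_∘_; id)
open import Function.Bundles using (_⇔_; mk⇔; Equivalence)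
open import Relation.Nullary using (¬_; Dec; yes; no; ¬?)
open import Relation.Nullary.Decidable using (_×-dec_; _⊎-dec_; decidable-stable)
open import Relation.Unary using (Decidable)
open import Relation.Binary.Definitions using (tri<; tri≈; tri>)
open import Relation.Binary.PropositionalEquality
  using (_≡_; _≢_; refl; sym; trans; cong; cong₂; subst; subst₂; module ≡-Reasoning)
open import Relation.Binary.Construct.Closure.Transitive as Plus using (TransClosure)

open Equivalence using (to; from)

-- Linear orders

-- IsLinOrder wrapped in a record, so that v can be inferred from a proof of Linear v.
record Linear {n} (v : Order n) : Set where
  constructor linear
  field lookup-injective : IsLinOrder v
open Linear public

prefers-lookup : ∀ {n} (v : Order n) {i j : Fin n} → toℕ i < toℕ j → Prefers v (lookup v i) (lookup v j)
prefers-lookup v {i} {j} i<j = i , j , i<j , refl , refl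

prefers-≡ : ∀ {n} {u u′ : Order n} {a b} → u ≡ u′ → Prefers u a b → Prefers u′ a b
prefers-≡ refl u-a≻b = u-a≻b

lookup-surjective : ∀ {n} {v : Order n} → Linear v → ∀ a → ∃[ i ] lookup v i ≡ a
-- If a were missed, punching it out would inject Fin (suc n) into Fin n.
lookup-surjective {suc n} {v} lin a with Finₚ.any? (λ i → lookup v i Finₚ.≟ a)
... | yes found = found
... | no missing =
  let i , j , i<j , e = Finₚ.pigeonhole (ℕₚ.n<1+n n) (λ i → Fin.punchOut (missing ∘ (i ,_) ∘ sym))
  in ⊥-elim (ℕₚ.<⇒≢ i<j (cong toℕ (lookup-injective lin i j (Finₚ.punchOut-injective {i = a} _ _ e))))

module _ {n} {v : Order n} (lin : Linear v) where

  private
    inj : ∀ i j → lookup v i ≡ lookup v j → i ≡ j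
    inj = lookup-injective lin

  prefers-trans : ∀ {a b c} → Prefers v a b → Prefers v b c → Prefers v a c
  prefers-trans (i , j , i<j , refl , eb) (j' , k , j'<k , eb' , ec) =
    i , k , ℕₚ.<-trans i<j (subst (λ x → toℕ x < toℕ k) (inj j' j (trans eb' (sym eb))) j'<k) , refl , ec

  prefers-irrefl : ∀ {a} → ¬ Prefers v a a
  prefers-irrefl (i , j , i<j , ea , ea') = ℕₚ.<⇒≢ i<j (cong toℕ (inj i j (trans ea (sym ea'))))

  prefers-asym : ∀ {a b} → Prefers v a b → ¬ Prefers v b a
  prefers-asym p q = prefers-irrefl (prefers-trans p q)

  prefers⇒≢ : ∀ {a b} → Prefers v a b → a ≢ b
  prefers⇒≢ p refl = prefers-irrefl p

  prefers-connex : ∀ {a b} → a ≢ b → Prefers v a b ⊎ Prefers v b a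
  prefers-connex {a} {b} a≢b with lookup-surjective lin a | lookup-surjective lin b
  ... | i , refl | j , refl with ℕₚ.<-cmp (toℕ i) (toℕ j)
  ...   | tri< i<j _ _ = inj₁ (prefers-lookup v i<j)
  ...   | tri≈ _ i≡j _ = ⊥-elim (a≢b (cong (lookup v) (Finₚ.toℕ-injective i≡j)))
  ...   | tri> _ _ j<i = inj₂ (prefers-lookup v j<i)

  ¬prefers⇒prefers : ∀ {a b} → a ≢ b → ¬ Prefers v a b → Prefers v b a
  ¬prefers⇒prefers a≢b ¬p with prefers-connex a≢b
  ... | inj₁ p = ⊥-elim (¬p p)
  ... | inj₂ p = p

lookup-extensionality : ∀ {n} {u v : Order n} → (∀ i → lookup u i ≡ lookup v i) → u ≡ v
lookup-extensionality {u = u} {v} eq = begin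
  u                   ≡⟨ Vecₚ.tabulate∘lookup u ⟨
  tabulate (lookup u) ≡⟨ Vecₚ.tabulate-cong eq ⟩
  tabulate (lookup v) ≡⟨ Vecₚ.tabulate∘lookup v ⟩
  v                   ∎
  where open ≡-Reasoning

private
  first-difference-moves-later : ∀ {n} {u v : Order n} {k} → Linear u →
    (∀ i → toℕ i < toℕ k → lookup u i ≡ lookup v i) → lookup u k ≢ lookup v k →
    ∀ {j} → lookup v j ≡ lookup u k → toℕ k < toℕ j
  first-difference-moves-later {u = u} {v} {k} lin-u agree differ {j} v[j]≡u[k] with ℕₚ.<-cmp (toℕ j) (toℕ k)
  ... | tri< j<k _ _ = ⊥-elim (ℕₚ.<⇒≢ j<k (cong toℕ (lookup-injective lin-u j k (trans (agree j j<k) v[j]≡u[k]))))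
  ... | tri≈ _ j≡k _ = ⊥-elim (differ (trans (sym v[j]≡u[k]) (cong (lookup v) (Finₚ.toℕ-injective j≡k))))
  ... | tri> _ _ k<j = k<j

-- At the first position k where u and v differ, u ranks u[k] above v[k] and v ranks v[k] above u[k].
disagreement : ∀ {n} {u v : Order n} → Linear u → Linear v → u ≢ v →
  ∃[ a ] ∃[ b ] (Prefers u a b × Prefers v b a)
disagreement {n} {u} {v} lin-u lin-v u≢v =
  let k , u[k]≢v[k] , below = Finₚ.¬∀⟶∃¬-smallest n _ (λ k → lookup u k Finₚ.≟ lookup v k)
                                                      (u≢v ∘ lookup-extensionality)
      agree : ∀ i → toℕ i < toℕ k → lookup u i ≡ lookup v i
      agree i i<k = subst (λ i′ → lookup u i′ ≡ lookup v i′) (inject-fromℕ< i<k) (below (fromℕ< i<k))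
      i , u[i]≡v[k] = lookup-surjective lin-u (lookup v k)
      j , v[j]≡u[k] = lookup-surjective lin-v (lookup u k)
      k<i = first-difference-moves-later {u = v} {u} lin-v (λ i i<k → sym (agree i i<k)) (u[k]≢v[k] ∘ sym) u[i]≡v[k]
      k<j = first-difference-moves-later {u = u} {v} lin-u agree u[k]≢v[k] v[j]≡u[k]
  in lookup u k , lookup v k , (k , i , k<i , refl , u[i]≡v[k]) , (k , j , k<j , refl , v[j]≡u[k])
  where
  inject-fromℕ< : ∀ {i k : Fin n} (i<k : toℕ i < toℕ k) → Fin.inject (fromℕ< i<k) ≡ i
  inject-fromℕ< i<k = Finₚ.toℕ-injective (trans (Finₚ.toℕ-inject (fromℕ< i<k)) (Finₚ.toℕ-fromℕ< i<k))

-- Adjacent transpositions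

Adjacent : ∀ {n} → Fin n → Fin n → Set
Adjacent p q = toℕ q ≡ suc (toℕ p)

adjacent-< : ∀ {n} {p q : Fin n} → Adjacent p q → toℕ p < toℕ q
adjacent-< {p = p} p⋖q = subst (toℕ p <_) (sym p⋖q) (ℕₚ.n<1+n _)

SamePair : {A : Set} → A → A → A → A → Set
SamePair x y c d = (c ≡ x × d ≡ y) ⊎ (c ≡ y × d ≡ x)

module _ {n} (p q : Fin n) where

  data TransposeView (i : Fin n) : Fin n → Set where
    at-p  : i ≡ p → TransposeView i q
    at-q  : i ≢ p → i ≡ q → TransposeView i p
    other : i ≢ p → i ≢ q → TransposeView i i

  transpose-view : ∀ i → TransposeView i (transpose p q i)
  transpose-view i with i Finₚ.≟ p
  ... | yes i≡p = at-p i≡p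
  ... | no i≢p with i Finₚ.≟ q
  ...   | yes i≡q = at-q i≢p i≡q
  ...   | no i≢q = other i≢p i≢q

  transpose-matchˡ : transpose p q p ≡ q
  transpose-matchˡ with transpose p q p | transpose-view p
  ... | _ | at-p _ = refl
  ... | _ | at-q p≢p _ = ⊥-elim (p≢p refl)
  ... | _ | other p≢p _ = ⊥-elim (p≢p refl)

  transpose-matchʳ : transpose p q q ≡ p
  transpose-matchʳ with transpose p q q | transpose-view q
  ... | _ | at-p q≡p = q≡p
  ... | _ | at-q _ _ = refl
  ... | _ | other _ q≢q = ⊥-elim (q≢q refl)

  transpose-other : ∀ {i} → i ≢ p → i ≢ q → transpose p q i ≡ i
  transpose-other {i} i≢p i≢q with transpose p q i | transpose-view i
  ... | _ | at-p i≡p = ⊥-elim (i≢p i≡p)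
  ... | _ | at-q _ i≡q = ⊥-elim (i≢q i≡q)
  ... | _ | other _ _ = refl

  transpose-involutive : ∀ i → transpose p q (transpose p q i) ≡ i
  transpose-involutive i with transpose p q i | transpose-view i
  ... | _ | at-p refl = transpose-matchʳ
  ... | _ | at-q _ refl = transpose-matchˡ
  ... | _ | other i≢p i≢q = transpose-other i≢p i≢q

  transpose-preserves-< : Adjacent p q → ∀ {i j} → toℕ i < toℕ j → ¬ (i ≡ p × j ≡ q) →
    toℕ (transpose p q i) < toℕ (transpose p q j)
  transpose-preserves-< p⋖q {i} {j} i<j not-pq with transpose p q i | transpose-view i | transpose p q j | transpose-view j
  ... | _ | at-p refl | _ | at-p refl = ⊥-elim (ℕₚ.<-irrefl refl i<j)
  ... | _ | at-p refl | _ | at-q _ refl = ⊥-elim (not-pq (refl , refl))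
  ... | _ | at-p refl | _ | other _ j≢q =
    ℕₚ.≤∧≢⇒< (subst (_≤ toℕ j) (sym p⋖q) i<j) (j≢q ∘ Finₚ.toℕ-injective ∘ sym)
  ... | _ | at-q _ refl | _ | at-p refl = ⊥-elim (ℕₚ.<-asym i<j (adjacent-< p⋖q))
  ... | _ | at-q _ refl | _ | at-q _ refl = ⊥-elim (ℕₚ.<-irrefl refl i<j)
  ... | _ | at-q _ refl | _ | other _ _ = ℕₚ.<-trans (adjacent-< p⋖q) i<j
  ... | _ | other _ _ | _ | at-p refl = ℕₚ.<-trans i<j (adjacent-< p⋖q)
  ... | _ | other i≢p _ | _ | at-q _ refl =
    ℕₚ.≤∧≢⇒< (ℕₚ.≤-pred (subst (toℕ i <_) p⋖q i<j)) (i≢p ∘ Finₚ.toℕ-injective)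
  ... | _ | other _ _ | _ | other _ _ = i<j

module _ {n} {p p′ q q′ : Fin n} (p≢q : p ≢ q) (p≢q′ : p ≢ q′) (p′≢q : p′ ≢ q) (p′≢q′ : p′ ≢ q′)
  where

  transpose-comm : ∀ i → transpose p p′ (transpose q q′ i) ≡ transpose q q′ (transpose p p′ i)
  transpose-comm i with transpose p p′ i | transpose-view p p′ i
  ... | _ | at-p refl =
    trans (cong (transpose p p′) (transpose-other q q′ p≢q p≢q′))
          (trans (transpose-matchˡ p p′) (sym (transpose-other q q′ p′≢q p′≢q′)))
  ... | _ | at-q _ refl =
    trans (cong (transpose p p′) (transpose-other q q′ p′≢q p′≢q′))
          (trans (transpose-matchʳ p p′) (sym (transpose-other q q′ p≢q p≢q′)))
  ... | _ | other i≢p i≢p′ with transpose q q′ i | transpose-view q q′ i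
  ...   | _ | at-p refl = transpose-other p p′ (p≢q′ ∘ sym) (p′≢q′ ∘ sym)
  ...   | _ | at-q _ refl = transpose-other p p′ (p≢q ∘ sym) (p′≢q ∘ sym)
  ...   | _ | other _ _ = transpose-other p p′ i≢p i≢p′

swap : ∀ {n} → Fin n → Fin n → Order n → Order n
swap p q v = tabulate (lookup v ∘ transpose p q)

lookup-swap : ∀ {n} (p q : Fin n) (v : Order n) i → lookup (swap p q v) i ≡ lookup v (transpose p q i)
lookup-swap p q v = Vecₚ.lookup∘tabulate _

module _ {n} {p q : Fin n} {v : Order n} where

  lookup-swapˡ : lookup (swap p q v) p ≡ lookup v q
  lookup-swapˡ = trans (lookup-swap p q v p) (cong (lookup v) (transpose-matchˡ p q))

  lookup-swapʳ : lookup (swap p q v) q ≡ lookup v p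
  lookup-swapʳ = trans (lookup-swap p q v q) (cong (lookup v) (transpose-matchʳ p q))

  lookup-swap-other : ∀ {i} → i ≢ p → i ≢ q → lookup (swap p q v) i ≡ lookup v i
  lookup-swap-other i≢p i≢q = trans (lookup-swap p q v _) (cong (lookup v) (transpose-other p q i≢p i≢q))

  swap-linear : Linear v → Linear (swap p q v)
  swap-linear lin = linear λ i j e →
    trans (sym (transpose-involutive p q i))
      (trans (cong (transpose p q) (lookup-injective lin _ _ (trans (sym (lookup-swap p q v i)) (trans e (lookup-swap p q v j)))))
             (transpose-involutive p q j))

  swap-involutive : swap p q (swap p q v) ≡ v
  swap-involutive = lookup-extensionality λ i →
    trans (lookup-swap p q (swap p q v) i)
      (trans (lookup-swap p q v (transpose p q i)) (cong (lookup v) (transpose-involutive p q i)))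

  swap-reverses : Adjacent p q → Prefers (swap p q v) (lookup v q) (lookup v p)
  swap-reverses p⋖q = p , q , adjacent-< p⋖q , lookup-swapˡ , lookup-swapʳ

  swap-preserves : Adjacent p q → ∀ {c d} → ¬ SamePair (lookup v p) (lookup v q) c d →
    Prefers v c d → Prefers (swap p q v) c d
  swap-preserves p⋖q other-pair (i , j , i<j , refl , refl) =
    transpose p q i , transpose p q j ,
    transpose-preserves-< p q p⋖q i<j (λ { (refl , refl) → other-pair (inj₁ (refl , refl)) }) ,
    trans (lookup-swap p q v _) (cong (lookup v) (transpose-involutive p q i)) ,
    trans (lookup-swap p q v _) (cong (lookup v) (transpose-involutive p q j))

  swap-reflects : Adjacent p q → ∀ {c d} → ¬ SamePair (lookup v p) (lookup v q) c d →
    Prefers (swap p q v) c d → Prefers v c d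
  swap-reflects p⋖q other-pair (i , j , i<j , refl , refl) =
    transpose p q i , transpose p q j ,
    transpose-preserves-< p q p⋖q i<j (λ { (refl , refl) → other-pair (inj₂ (lookup-swapˡ , lookup-swapʳ)) }) ,
    sym (lookup-swap p q v i) , sym (lookup-swap p q v j)

swap-comm : ∀ {n} {p p′ q q′ : Fin n} → p ≢ q → p ≢ q′ → p′ ≢ q → p′ ≢ q′ →
  ∀ v → swap q q′ (swap p p′ v) ≡ swap p p′ (swap q q′ v)
swap-comm {p = p} {p′} {q} {q′} p≢q p≢q′ p′≢q p′≢q′ v = lookup-extensionality λ i →
  trans (lookup-swap q q′ (swap p p′ v) i) (trans (lookup-swap p p′ v (transpose q q′ i))
    (trans (cong (lookup v) (transpose-comm p≢q p≢q′ p′≢q p′≢q′ i))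
           (sym (trans (lookup-swap p p′ (swap q q′ v) i) (lookup-swap q q′ v (transpose p p′ i))))))

-- Majorities of profiles on a chain

countBy : {A : Set} {P : A → Set} → Decidable P → List A → ℕ
countBy P? xs = length (filter P? xs)

countBy-mono : {A : Set} {P Q : A → Set} (P? : Decidable P) (Q? : Decidable Q) {xs : List A} →
  All (λ x → P x → Q x) xs → countBy P? xs ≤ countBy Q? xs
countBy-mono P? Q? [] = z≤n
countBy-mono P? Q? {x ∷ _} (P⇒Q ∷ rest) with P? x | Q? x
... | yes _ | yes _ = s≤s (countBy-mono P? Q? rest)
... | yes p | no ¬q = ⊥-elim (¬q (P⇒Q p))
... | no _  | yes _ = ℕₚ.m≤n⇒m≤1+n (countBy-mono P? Q? rest)
... | no _  | no _  = countBy-mono P? Q? rest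

module _ {A : Set} {P : A → Set} (P? : Decidable P) {x : A} {xs : List A} where

  countBy-accept : P x → countBy P? (x ∷ xs) ≡ suc (countBy P? xs)
  countBy-accept p = cong length (Listₚ.filter-accept P? p)

  countBy-reject : ¬ P x → countBy P? (x ∷ xs) ≡ countBy P? xs
  countBy-reject ¬p = cong length (Listₚ.filter-reject P? ¬p)

countBy-<+≥ : ∀ t J → countBy (_<? t) J + countBy (t ≤?_) J ≡ length J
countBy-<+≥ t [] = refl
countBy-<+≥ t (i ∷ J) with ℕₚ.<-≤-connex i t
... | inj₁ i<t = trans (cong₂ _+_ (countBy-accept (_<? t) i<t) (countBy-reject (t ≤?_) (ℕₚ.<⇒≱ i<t)))
                       (cong suc (countBy-<+≥ t J))
... | inj₂ t≤i = trans (cong₂ _+_ (countBy-reject (_<? t) (ℕₚ.≤⇒≯ t≤i)) (countBy-accept (t ≤?_) t≤i))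
                       (trans (ℕₚ.+-suc _ _) (cong suc (countBy-<+≥ t J)))

count-map : ∀ {n} (f : ℕ → Order n) J a b → count (map f J) a b ≡ countBy (λ i → prefers? (f i) a b) J
count-map f [] a b = refl
count-map f (i ∷ J) a b with prefers? (f i) a b
... | yes _ = cong suc (count-map f J a b)
... | no _  = count-map f J a b

count-++ : ∀ {n} (P Q : List (Order n)) a b → count (P ++ Q) a b ≡ count P a b + count Q a b
count-++ P Q a b = trans (cong length (Listₚ.filter-++ _ P Q)) (Listₚ.length-++ (filter _ P))

count-replicate : ∀ {n} k (v : Order n) a b → count (replicate k v) a b ≡ k * count (v ∷ []) a b
count-replicate zero v a b = refl
count-replicate (suc k) v a b =
  trans (count-++ (v ∷ []) (replicate k v) a b) (cong (count (v ∷ []) a b +_) (count-replicate k v a b))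

count-singleton-cong : ∀ {n} {u u′ : Order n} {a b} →
  (Prefers u a b → Prefers u′ a b) → (Prefers u′ a b → Prefers u a b) →
  count (u ∷ []) a b ≡ count (u′ ∷ []) a b
count-singleton-cong {u = u} {u′} {a} {b} to from with prefers? u a b | prefers? u′ a b
... | yes _ | yes _ = refl
... | yes p | no ¬p′ = ⊥-elim (¬p′ (to p))
... | no ¬p | yes p′ = ⊥-elim (¬p (from p′))
... | no _ | no _ = refl

Dominated : ∀ {n} → List (Order n) → Set
Dominated P = ∃[ u ] (Linear u × (∀ {a b} → Majority P a b → Prefers u a b))

dominated⇒acyclic : ∀ {n} {P : List (Order n)} → Dominated P → Acyclic (Majority P)
dominated⇒acyclic {P = P} (u , lin , majority⊆u) a cycle = prefers-irrefl lin (along cycle)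
  where
  along : ∀ {x y} → TransClosure (Majority P) x y → Prefers u x y
  along Plus.[ x≻y ] = majority⊆u x≻y
  along (x≻y Plus.∷ rest) = prefers-trans lin (majority⊆u x≻y) (along rest)

dominated-by-counts : ∀ {n} {P Q : List (Order n)} → (∀ a b → count P a b ≡ count Q a b) → Dominated Q → Dominated P
dominated-by-counts P≋Q (u , lin , majority⊆u) =
  u , lin , λ {a} {b} maj → majority⊆u (subst₂ _<_ (P≋Q b a) (P≋Q a b) maj)

Between : ∀ {n} → Order n → Order n → Order n → Set
Between u w v = ∀ {a b} → Prefers u a b → Prefers v a b → Prefers w a b

between-covered : ∀ {n} {u v w : Order n} → Linear u → Linear v → Linear w → Between u w v →
  ∀ {a b} → Prefers w a b → Prefers u a b ⊎ Prefers v a b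
between-covered {u = u} {v} lin-u lin-v lin-w w-between {a} {b} w-a≻b with prefers? u a b | prefers? v a b
... | yes u-a≻b | _ = inj₁ u-a≻b
... | no _ | yes v-a≻b = inj₂ v-a≻b
... | no u-a⊁b | no v-a⊁b = ⊥-elim (prefers-asym lin-w w-a≻b
  (w-between (¬prefers⇒prefers lin-u a≢b u-a⊁b) (¬prefers⇒prefers lin-v a≢b v-a⊁b)))
  where
  a≢b : a ≢ b
  a≢b = prefers⇒≢ lin-w w-a≻b

Convex : ∀ {n} → (ℕ → Order n) → ℕ → Set
Convex f m = ∀ {i j k} → i ≤ j → j ≤ k → k < m → Between (f i) (f j) (f k)

AllLinear : ∀ {n} → (ℕ → Order n) → ℕ → Set
AllLinear f m = ∀ {i} → i < m → Linear (f i)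

InRange : ∀ {n} → (ℕ → Order n) → ℕ → Order n → Set
InRange f m v = ∃[ i ] (i < m × f i ≡ v)

allFin-linear : ∀ {n} → Linear (allFin n)
allFin-linear = linear λ i j e → trans (sym (Vecₚ.lookup-allFin i)) (trans e (Vecₚ.lookup-allFin j))

crossing-point : (F : ℕ → ℕ) {N : ℕ} → ∀ m → F 0 ≤ N → N ≤ F (suc m) →
  ∃[ t ] (t ≤ m × F t ≤ N × N ≤ F (suc t))
crossing-point F zero F0≤N N≤F1 = 0 , z≤n , F0≤N , N≤F1
crossing-point F {N} (suc m) F0≤N N≤F with N ≤? F (suc m)
... | yes N≤F′ = let t , t≤m , crossing = crossing-point F m F0≤N N≤F′ in t , ℕₚ.m≤n⇒m≤1+n t≤m , crossing
... | no N≰F′ = suc m , ℕₚ.≤-refl , ℕₚ.<⇒≤ (ℕₚ.≰⇒> N≰F′) , N≤F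

private
  ≤-from-double : ∀ {x y} → 2 * x ≤ x + y → x ≤ y
  ≤-from-double {x} {y} 2x≤x+y = subst (_≤ y) (ℕₚ.+-identityʳ x) (ℕₚ.+-cancelˡ-≤ x _ _ 2x≤x+y)

  ≥-from-double : ∀ {x y} → x + y ≤ 2 * x → y ≤ x
  ≥-from-double {x} {y} x+y≤2x = subst (y ≤_) (ℕₚ.+-identityʳ x) (ℕₚ.+-cancelˡ-≤ x _ _ x+y≤2x)

module _ {n} {f : ℕ → Order n} {m : ℕ} (lin : AllLinear f m) (convex : Convex f m) where

  prefers-before-reversal : ∀ {i j k c d} → i ≤ j → j < m →
    Prefers (f i) c d → Prefers (f j) d c → k ≤ i → Prefers (f k) c d
  prefers-before-reversal {i} {j} {k} {c} {d} i≤j j<m c≻d d≻c k≤i with prefers? (f k) c d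
  ... | yes k-c≻d = k-c≻d
  ... | no k-c⊁d = ⊥-elim (prefers-asym (lin i<m) c≻d (convex k≤i i≤j j<m k-d≻c d≻c))
    where
    i<m : i < m
    i<m = ℕₚ.≤-<-trans i≤j j<m
    k-d≻c : Prefers (f k) d c
    k-d≻c = ¬prefers⇒prefers (lin (ℕₚ.≤-<-trans k≤i i<m)) (prefers⇒≢ (lin i<m) c≻d) k-c⊁d

  prefers-after-reversal : ∀ {i j k c d} → i ≤ j →
    Prefers (f i) c d → Prefers (f j) d c → j ≤ k → k < m → Prefers (f k) d c
  prefers-after-reversal {i} {j} {k} {c} {d} i≤j c≻d d≻c j≤k k<m with prefers? (f k) d c
  ... | yes k-d≻c = k-d≻c
  ... | no k-d⊁c = ⊥-elim (prefers-asym (lin j<m) d≻c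
                     (convex i≤j j≤k k<m c≻d (¬prefers⇒prefers (lin k<m) (prefers⇒≢ (lin j<m) d≻c) k-d⊁c)))
    where
    j<m : j < m
    j<m = ℕₚ.≤-<-trans j≤k k<m

  -- lower and upper make t a median position of J. If f t preferred b to a, convexity would place all
  -- voters preferring a to b on one side of t, where they cannot form a majority.
  median-prefers : ∀ J → All (_< m) J → ∀ t →
    2 * countBy (_<? t) J ≤ length J → length J ≤ 2 * countBy (_<? suc t) J →
    ∀ {a b} → Majority (map f J) a b → Prefers (f t) a b
  median-prefers J J<m t lower upper {a} {b} maj with prefers? (f t) a b
  ... | yes t-a≻b = t-a≻b
  ... | no t-a⊁b = ⊥-elim (ℕₚ.<⇒≱ maj′ (count-sides (Any.any? (λ i → (i <? t) ×-dec prefers? (f i) a b) J)))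
    where
    voters : Fin n → Fin n → ℕ
    voters a b = countBy (λ i → prefers? (f i) a b) J

    maj′ : voters b a < voters a b
    maj′ = subst₂ _<_ (count-map f J b a) (count-map f J a b) maj

    b≻a-unless-a≻b : ∀ {i} → i < m → ¬ Prefers (f i) a b → Prefers (f i) b a
    b≻a-unless-a≻b i<m = ¬prefers⇒prefers (lin i<m) λ { refl → ℕₚ.<-irrefl refl maj′ }

    minority : ∀ {S T : ℕ → Set} (S? : Decidable S) (T? : Decidable T) →
      All (λ i → Prefers (f i) a b → S i) J → All (λ i → T i → Prefers (f i) b a) J →
      countBy S? J ≤ countBy T? J → voters a b ≤ voters b a
    minority S? T? a≻b⇒S T⇒b≻a S≤T =
      ℕₚ.≤-trans (countBy-mono _ S? a≻b⇒S) (ℕₚ.≤-trans S≤T (countBy-mono T? _ T⇒b≻a))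

    count-sides : Dec (Any (λ i → i < t × Prefers (f i) a b) J) → voters a b ≤ voters b a
    count-sides (yes early) = minority (_<? t) (t ≤?_) (All.map before J<m)
      (All.map (λ i<m t≤i → b≻a-unless-a≻b i<m (ℕₚ.≤⇒≯ t≤i ∘ before i<m)) J<m)
      (≤-from-double (subst (2 * countBy (_<? t) J ≤_) (sym (countBy-<+≥ t J)) lower))
      where
      before : ∀ {i} → i < m → Prefers (f i) a b → i < t
      before {i} i<m a≻b with i <? t
      ... | yes i<t = i<t
      ... | no i≮t = let i₀ , i₀<t , i₀-a≻b = Any.satisfied early
                     in ⊥-elim (t-a⊁b (convex (ℕₚ.<⇒≤ i₀<t) (ℕₚ.≮⇒≥ i≮t) i<m i₀-a≻b a≻b))
    count-sides (no none-early) = minority (suc t ≤?_) (_<? suc t)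
      (All.map (λ { (i<m , not-early) → after i<m not-early }) J-info)
      (All.map (λ { (i<m , not-early) i≤t → b≻a-unless-a≻b i<m (up-to i≤t not-early) }) J-info)
      (≥-from-double (subst (_≤ 2 * countBy (_<? suc t) J) (sym (countBy-<+≥ (suc t) J)) upper))
      where
      J-info : All (λ i → i < m × ¬ (i < t × Prefers (f i) a b)) J
      J-info = All.zip (J<m , AllP.¬Any⇒All¬ J none-early)
      up-to : ∀ {i} → i < suc t → ¬ (i < t × Prefers (f i) a b) → ¬ Prefers (f i) a b
      up-to i<1+t not-early a≻b with ℕₚ.m≤n⇒m<n∨m≡n (ℕₚ.≤-pred i<1+t)
      ... | inj₁ i<t = not-early (i<t , a≻b)
      ... | inj₂ refl = t-a⊁b a≻b
      after : ∀ {i} → i < m → ¬ (i < t × Prefers (f i) a b) → Prefers (f i) a b → suc t ≤ i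
      after {i} i<m not-early a≻b = ℕₚ.≰⇒> λ i≤t → up-to (s≤s i≤t) not-early a≻b

  median-dominates : ∀ J → All (_< m) J → Dominated (map f J)
  median-dominates [] [] = allFin n , allFin-linear , λ ()
  median-dominates J@(_ ∷ _) J<m@(i<m ∷ _) =
    let t , t≤m-1 , lower , upper = crossing-point (λ t → 2 * countBy (_<? t) J) (pred m) none-before-0
                                      (subst (λ m → length J ≤ 2 * countBy (_<? m) J) (sym (ℕₚ.suc-pred m)) all-before-m)
    in f t , lin (ℕₚ.m≤pred[n]⇒suc[m]≤n t≤m-1) , median-prefers J J<m t lower upper
    where
    instance
      m≢0 : NonZero m
      m≢0 = >-nonZero (ℕₚ.≤-<-trans z≤n i<m)
    none-before-0 : 2 * countBy (_<? 0) J ≤ length J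
    none-before-0 =
      subst (λ c → 2 * c ≤ length J) (sym (cong length (Listₚ.filter-none (_<? 0) (All.universal (λ _ ()) J)))) z≤n
    all-before-m : length J ≤ 2 * countBy (_<? m) J
    all-before-m =
      subst (λ c → length J ≤ 2 * c) (sym (cong length (Listₚ.filter-all (_<? m) J<m))) (ℕₚ.m≤m+n (length J) _)

  profile-indices : ∀ {P} → All (InRange f m) P → ∃[ J ] (All (_< m) J × map f J ≡ P)
  profile-indices [] = [] , [] , refl
  profile-indices ((i , i<m , refl) ∷ rest) with profile-indices rest
  ... | J , J<m , refl = i ∷ J , i<m ∷ J<m , refl

  chain-profile-dominated : ∀ {P} → All (InRange f m) P → Dominated P
  chain-profile-dominated P-in-range with profile-indices P-in-range
  ... | J , J<m , refl = median-dominates J J<m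

  chain-condorcet : ∀ {D} → All IsLinOrder D → (∀ {v} → v ∈ D → InRange f m v) → IsCondorcet D
  chain-condorcet D-linear covers =
    D-linear , λ P P⊆D → dominated⇒acyclic {P = P} (chain-profile-dominated (All.map covers P⊆D))

-- Single-crossing chains and their extensions

module _ {A : Set} (default : A) where

  nth : List A → ℕ → A
  nth [] _ = default
  nth (x ∷ _) zero = x
  nth (_ ∷ xs) (suc i) = nth xs i

  nth-∈ : ∀ xs {i} → i < length xs → nth xs i ∈ xs
  nth-∈ (x ∷ xs) {zero} _ = here refl
  nth-∈ (x ∷ xs) {suc i} (s≤s i<len) = there (nth-∈ xs i<len)

  ∈⇒nth : ∀ {x} xs → x ∈ xs → ∃[ i ] (i < length xs × nth xs i ≡ x)
  ∈⇒nth (_ ∷ _) (here refl) = 0 , s≤s z≤n , refl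
  ∈⇒nth (_ ∷ xs) (there x∈xs) = let i , i<len , e = ∈⇒nth xs x∈xs in suc i , s≤s i<len , e

  lookup≡nth : ∀ xs (i : Fin (length xs)) → List.lookup xs i ≡ nth xs (toℕ i)
  lookup≡nth (x ∷ xs) Fin.zero = refl
  lookup≡nth (x ∷ xs) (Fin.suc i) = lookup≡nth xs i

  nth-injective : ∀ {xs} → Unique xs → ∀ {i j} → i < length xs → j < length xs → nth xs i ≡ nth xs j → i ≡ j
  nth-injective {_ ∷ _} (_ ∷ _) {zero} {zero} _ _ _ = refl
  nth-injective {_ ∷ xs} (x∉xs ∷ _) {zero} {suc j} _ (s≤s j<len) e = ⊥-elim (All.lookup x∉xs (nth-∈ xs j<len) e)
  nth-injective {_ ∷ xs} (x∉xs ∷ _) {suc i} {zero} (s≤s i<len) _ e =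
    ⊥-elim (All.lookup x∉xs (nth-∈ xs i<len) (sym e))
  nth-injective {_ ∷ _} (_ ∷ unique) {suc i} {suc j} (s≤s i<len) (s≤s j<len) e =
    cong suc (nth-injective unique i<len j<len e)

record SingleCrossingChain {n} (D : Domain n) : Set where
  field
    m : ℕ
    f : ℕ → Order n
    complete : ∀ {v} → v ∈ D → InRange f m v
    sound : ∀ {i} → i < m → f i ∈ D
    linear-at : AllLinear f m
    convex : Convex f m
    injective : ∀ {i j} → i < m → j < m → f i ≡ f j → i ≡ j

single-crossing-chain : ∀ {n} {D : Domain n} → IsSingleCrossing D → All IsLinOrder D → SingleCrossingChain D
single-crossing-chain {n} {D} (L , unique , L⇔D , crossing) D-linear = record
  { m = length L
  ; f = f
  ; complete = ∈⇒nth (allFin n) L ∘ from (L⇔D _)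
  ; sound = sound
  ; linear-at = λ i<m → linear (All.lookup D-linear (sound i<m))
  ; convex = convex
  ; injective = nth-injective (allFin n) unique
  }
  where
  f : ℕ → Order n
  f = nth (allFin n) L

  sound : ∀ {i} → i < length L → f i ∈ D
  sound i<m = to (L⇔D _) (nth-∈ (allFin n) L i<m)

  f≡lookup : ∀ {i} (i<m : i < length L) → f i ≡ List.lookup L (fromℕ< i<m)
  f≡lookup i<m = sym (trans (lookup≡nth (allFin n) L (fromℕ< i<m)) (cong f (Finₚ.toℕ-fromℕ< i<m)))

  convex : Convex f (length L)
  convex {i} {j} {k} i≤j j≤k k<m {a} {b} i-a≻b k-a≻b = prefers-≡ (sym (f≡lookup j<m)) (from-segment (crossing a b))
    where
    j<m : j < length L
    j<m = ℕₚ.≤-<-trans j≤k k<m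
    i<m : i < length L
    i<m = ℕₚ.≤-<-trans i≤j j<m
    from-segment : IsInitialOrFinal (λ (i : Fin (length L)) → Prefers (List.lookup L i) a b) →
      Prefers (List.lookup L (fromℕ< j<m)) a b
    from-segment (K , _ , inj₁ initial) =
      let k<K = subst (_< K) (Finₚ.toℕ-fromℕ< k<m) (to (initial _) (prefers-≡ (f≡lookup k<m) k-a≻b))
      in from (initial _) (subst (_< K) (sym (Finₚ.toℕ-fromℕ< j<m)) (ℕₚ.≤-<-trans j≤k k<K))
    from-segment (K , _ , inj₂ final) =
      let K≤i = subst (K ≤_) (Finₚ.toℕ-fromℕ< i<m) (to (final _) (prefers-≡ (f≡lookup i<m) i-a≻b))
      in from (final _) (subst (K ≤_) (sym (Finₚ.toℕ-fromℕ< j<m)) (ℕₚ.≤-trans K≤i i≤j))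

_◅_ : ∀ {n} → Order n → (ℕ → Order n) → ℕ → Order n
(w ◅ f) zero = w
(w ◅ f) (suc k) = f k

module _ {n} {f : ℕ → Order n} {m} (lin : AllLinear f m) (convex : Convex f m) {w : Order n} where

  prepend-linear : Linear w → AllLinear (w ◅ f) (suc m)
  prepend-linear lin-w {zero} _ = lin-w
  prepend-linear _ {suc i} (s≤s i<m) = lin i<m

  prepend-convex : (∀ {k} → k < m → Between w (f 0) (f k)) → Convex (w ◅ f) (suc m)
  prepend-convex _ {zero} {zero} _ _ _ w-a≻b _ = w-a≻b
  prepend-convex w-before {zero} {suc j} {suc k} _ (s≤s j≤k) (s≤s k<m) w-a≻b k-a≻b =
    convex z≤n j≤k k<m (w-before k<m w-a≻b k-a≻b) k-a≻b
  prepend-convex _ {zero} {suc _} {zero} _ ()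
  prepend-convex _ {suc _} {zero} ()
  prepend-convex _ {suc i} {suc j} {suc k} (s≤s i≤j) (s≤s j≤k) (s≤s k<m) = convex i≤j j≤k k<m

splice : ∀ {n} → (ℕ → ℕ) → ℕ → Order n → (ℕ → Order n) → ℕ → Order n
splice ρ e w f k with k ≟ e
... | yes _ = w
... | no _ = f (ρ k)

module _ {n} (ρ : ℕ → ℕ) (e : ℕ) (w : Order n) (f : ℕ → Order n) where

  splice-at : splice ρ e w f e ≡ w
  splice-at with e ≟ e
  ... | yes _ = refl
  ... | no e≢e = ⊥-elim (e≢e refl)

  splice-off : ∀ {k} → k ≢ e → splice ρ e w f k ≡ f (ρ k)
  splice-off {k} k≢e with k ≟ e
  ... | yes k≡e = ⊥-elim (k≢e k≡e)
  ... | no _ = refl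

-- Both inserting (ρ = skip e) and replacing (ρ = id) an order of a chain are splices.
module Splice {n} {f : ℕ → Order n} {m} (lin : AllLinear f m) (convex : Convex f m)
  (ρ : ℕ → ℕ) (ρ-mono : ∀ {k k′} → k ≤ k′ → ρ k ≤ ρ k′)
  (e m′ : ℕ) (ρ<m : ∀ {k} → k < m′ → k ≢ e → ρ k < m)
  {L R : ℕ} (ρ≤L : ∀ {k} → k < e → ρ k ≤ L) (L≤R : L ≤ R) (R≤ρ : ∀ {k} → e < k → R ≤ ρ k) (R<m : R < m)
  {w : Order n} (lin-w : Linear w) (w-between : Between (f L) w (f R)) where

  private
    g : ℕ → Order n
    g = splice ρ e w f
    L<m : L < m
    L<m = ℕₚ.≤-<-trans L≤R R<m

    at-e : g e ≡ w
    at-e = splice-at ρ e w f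
    off-e : ∀ {k} → k ≢ e → g k ≡ f (ρ k)
    off-e = splice-off ρ e w f

    to-w : ∀ {a b} → Prefers (g e) a b → Prefers w a b
    to-w {a} {b} = subst (λ v → Prefers v a b) at-e
    from-w : ∀ {a b} → Prefers w a b → Prefers (g e) a b
    from-w {a} {b} = subst (λ v → Prefers v a b) (sym at-e)
    to-f : ∀ {k a b} → k ≢ e → Prefers (g k) a b → Prefers (f (ρ k)) a b
    to-f {a = a} {b} k≢e = subst (λ v → Prefers v a b) (off-e k≢e)
    from-f : ∀ {k a b} → k ≢ e → Prefers (f (ρ k)) a b → Prefers (g k) a b
    from-f {a = a} {b} k≢e = subst (λ v → Prefers v a b) (sym (off-e k≢e))

  splice-linear : AllLinear g m′
  splice-linear {k} k<m′ = by-cases (k ≟ e)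
    where
    by-cases : Dec (k ≡ e) → Linear (g k)
    by-cases (yes refl) = subst Linear (sym at-e) lin-w
    by-cases (no k≢e) = subst Linear (sym (off-e k≢e)) (lin (ρ<m k<m′ k≢e))

  splice-convex : Convex g m′
  splice-convex {i} {j} {k} i≤j j≤k k<m′ {a} {b} i-a≻b k-a≻b with i ≟ j | j ≟ k
  ... | yes refl | _ = i-a≻b
  ... | _ | yes refl = k-a≻b
  ... | no i≢j | no j≢k = by-cases (j ≟ e) (i ≟ e) (k ≟ e)
    where
    by-cases : Dec (j ≡ e) → Dec (i ≡ e) → Dec (k ≡ e) → Prefers (g j) a b
    by-cases (yes refl) _ _ =
      let i<e = ℕₚ.≤∧≢⇒< i≤j i≢j ; e<k = ℕₚ.≤∧≢⇒< j≤k j≢k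
          i-f = to-f (ℕₚ.<⇒≢ i<e) i-a≻b ; k-f = to-f (ℕₚ.<⇒≢ e<k ∘ sym) k-a≻b
          ρk<m = ρ<m k<m′ (ℕₚ.<⇒≢ e<k ∘ sym)
      in from-w (w-between (convex (ρ≤L i<e) (ℕₚ.≤-trans L≤R (R≤ρ e<k)) ρk<m i-f k-f)
                           (convex (ℕₚ.≤-trans (ρ≤L i<e) L≤R) (R≤ρ e<k) ρk<m i-f k-f))
    by-cases (no j≢e) (yes refl) (yes refl) = ⊥-elim (i≢j (ℕₚ.≤-antisym i≤j j≤k))
    by-cases (no j≢e) (yes refl) (no k≢e) =
      let e<j = ℕₚ.≤∧≢⇒< i≤j i≢j
          k-f = to-f k≢e k-a≻b
          ρk<m = ρ<m k<m′ k≢e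
          ρj≤ρk = ρ-mono j≤k
      in from-f j≢e ([ (λ L-a≻b → convex (ℕₚ.≤-trans L≤R (R≤ρ e<j)) ρj≤ρk ρk<m L-a≻b k-f)
                     , (λ R-a≻b → convex (R≤ρ e<j) ρj≤ρk ρk<m R-a≻b k-f) ]
                     (between-covered (lin L<m) (lin R<m) lin-w w-between (to-w i-a≻b)))
    by-cases (no j≢e) (no i≢e) (yes refl) =
      let j<e = ℕₚ.≤∧≢⇒< j≤k j≢k
          i-f = to-f i≢e i-a≻b
          ρi≤ρj = ρ-mono i≤j
      in from-f j≢e ([ (λ L-a≻b → convex ρi≤ρj (ρ≤L j<e) L<m i-f L-a≻b)
                     , (λ R-a≻b → convex ρi≤ρj (ℕₚ.≤-trans (ρ≤L j<e) L≤R) R<m i-f R-a≻b) ]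
                     (between-covered (lin L<m) (lin R<m) lin-w w-between (to-w k-a≻b)))
    by-cases (no j≢e) (no i≢e) (no k≢e) =
      from-f j≢e (convex (ρ-mono i≤j) (ρ-mono j≤k) (ρ<m k<m′ k≢e) (to-f i≢e i-a≻b) (to-f k≢e k-a≻b))

skip : ℕ → ℕ → ℕ
skip _ zero = zero
skip zero (suc k) = k
skip (suc e) (suc k) = suc (skip e k)

skip-below : ∀ {e k} → k ≤ e → skip e k ≡ k
skip-below z≤n = refl
skip-below (s≤s k≤e) = cong suc (skip-below k≤e)

skip-above : ∀ {e k} → e ≤ k → skip e (suc k) ≡ k
skip-above {zero} _ = refl
skip-above {suc e} (s≤s e≤k) = cong suc (skip-above e≤k)

skip-mono : ∀ {e k k′} → k ≤ k′ → skip e k ≤ skip e k′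
skip-mono {_} {zero} _ = z≤n
skip-mono {zero} (s≤s k≤k′) = k≤k′
skip-mono {suc e} (s≤s k≤k′) = s≤s (skip-mono k≤k′)

module _ {n} {f : ℕ → Order n} {m} (lin : AllLinear f m) (convex : Convex f m) where

  module _ {i} (1+i<m : suc i < m) {w : Order n} (lin-w : Linear w) (w-between : Between (f i) w (f (suc i))) where

    private
      ρ<m : ∀ {k} → k < suc m → k ≢ suc i → skip (suc i) k < m
      ρ<m {k} k<1+m k≢1+i with ℕₚ.≤-<-connex k (suc i)
      ... | inj₁ k≤1+i = subst (_< m) (sym (skip-below k≤1+i)) (ℕₚ.<-trans (ℕₚ.≤∧≢⇒< k≤1+i k≢1+i) 1+i<m)
      ... | inj₂ (s≤s 1+i≤k′) = subst (_< m) (sym (skip-above 1+i≤k′)) (ℕₚ.≤-pred k<1+m)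

      ρ≤L : ∀ {k} → k < suc i → skip (suc i) k ≤ i
      ρ≤L k<1+i = subst (_≤ _) (sym (skip-below (ℕₚ.<⇒≤ k<1+i))) (ℕₚ.≤-pred k<1+i)

      R≤ρ : ∀ {k} → suc i < k → suc i ≤ skip (suc i) k
      R≤ρ (s≤s 1+i≤k′) = subst (_ ≤_) (sym (skip-above 1+i≤k′)) 1+i≤k′

    open Splice lin convex (skip (suc i)) skip-mono (suc i) (suc m) ρ<m ρ≤L (ℕₚ.n≤1+n i) R≤ρ 1+i<m lin-w w-between
      renaming (splice-linear to insert-linear; splice-convex to insert-convex) public

  module _ {t} (2+t<m : suc (suc t) < m) {w : Order n} (lin-w : Linear w) (w-between : Between (f t) w (f (suc (suc t)))) where

    open Splice lin convex id (λ k≤k′ → k≤k′) (suc t) m (λ k<m _ → k<m) ℕₚ.≤-pred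
                (ℕₚ.≤-trans (ℕₚ.n≤1+n t) (ℕₚ.n≤1+n (suc t))) (λ e<k → e<k) 2+t<m lin-w w-between
      renaming (splice-linear to replace-linear; splice-convex to replace-convex) public

insert-covers : ∀ {n} {f : ℕ → Order n} {m e w v} → InRange f m v → InRange (splice (skip e) e w f) (suc m) v
insert-covers {f = f} {e = e} {w} (i , i<m , refl) with ℕₚ.<-≤-connex i e
... | inj₁ i<e =
  i , ℕₚ.m<n⇒m<1+n i<m , trans (splice-off (skip e) e w f (ℕₚ.<⇒≢ i<e)) (cong f (skip-below (ℕₚ.<⇒≤ i<e)))
... | inj₂ e≤i =
  suc i , s≤s i<m , trans (splice-off (skip e) e w f (ℕₚ.<⇒≢ (s≤s e≤i) ∘ sym)) (cong f (skip-above e≤i))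

replace-covers : ∀ {n} {f : ℕ → Order n} {m e w v} → InRange f m v → v ≢ f e → InRange (splice id e w f) m v
replace-covers {f = f} {e = e} {w} (i , i<m , refl) v≢f[e] = i , i<m , splice-off id e w f λ { refl → v≢f[e] refl }

-- Maximal single-crossing Condorcet domains

adjacent-chain : ∀ {n} (v : Order n) (R : Fin n → Fin n → Set) → (∀ {x y z} → R x y → R y z → R x z) →
  (∀ {r r′} → Adjacent r r′ → R (lookup v r) (lookup v r′)) →
  ∀ {p q} → toℕ p < toℕ q → R (lookup v p) (lookup v q)
adjacent-chain {n} v R R-trans R-adjacent {p} {q} p<q = along _ q (proj₂ (ℕₚ.m≤n⇒∃[o]m+o≡n p<q))
  where
  along : ∀ d (q : Fin n) → suc (toℕ p + d) ≡ toℕ q → R (lookup v p) (lookup v q)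
  along zero q gap = R-adjacent (trans (sym gap) (cong suc (ℕₚ.+-identityʳ (toℕ p))))
  along (suc d) q gap = R-trans (along d q′ (sym (Finₚ.toℕ-fromℕ< q′<n))) (R-adjacent q′⋖q)
    where
    q′<n : suc (toℕ p + d) < n
    q′<n = ℕₚ.<-trans (subst (suc (toℕ p + d) <_) (trans (cong suc (sym (ℕₚ.+-suc (toℕ p) d))) gap) (ℕₚ.n<1+n _))
                      (Finₚ.toℕ<n q)
    q′ : Fin n
    q′ = fromℕ< q′<n
    q′⋖q : Adjacent q′ q
    q′⋖q = trans (sym gap) (trans (cong suc (ℕₚ.+-suc (toℕ p) d)) (cong suc (sym (Finₚ.toℕ-fromℕ< q′<n))))

adjacent-witness : ∀ {n} (v : Order n) {R : Fin n → Fin n → Set} → (∀ x y → Dec (R x y)) →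
  (∀ {x y z} → R x y → R y z → R x z) → ∀ {p q} → toℕ p < toℕ q → ¬ R (lookup v p) (lookup v q) →
  ∃[ r ] ∃[ r′ ] (Adjacent r r′ × ¬ R (lookup v r) (lookup v r′))
adjacent-witness v {R} R? R-trans p<q ¬R
  with Finₚ.any? (λ r → Finₚ.any? (λ r′ → (toℕ r′ ≟ suc (toℕ r)) ×-dec ¬? (R? (lookup v r) (lookup v r′))))
... | yes witness = witness
... | no none = ⊥-elim (¬R (adjacent-chain v R R-trans
                  (λ {r} {r′} r⋖r′ → decidable-stable (R? _ _) (λ ¬R′ → none (r , r′ , r⋖r′ , ¬R′))) p<q))

same-pair? : ∀ {n} (x y c d : Fin n) → Dec (SamePair x y c d)
same-pair? x y c d = ((c Finₚ.≟ x) ×-dec (d Finₚ.≟ y)) ⊎-dec ((c Finₚ.≟ y) ×-dec (d Finₚ.≟ x))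

private
  open +-*-Solver using (solve; _:+_; _:*_; _:=_; con)

  absorb-one : ∀ W C α Y β → W + (C + (α * W + β * Y)) ≡ C + (suc α * W + β * Y)
  absorb-one = solve 5 (λ W C α Y β → W :+ (C :+ (α :* W :+ β :* Y)) := C :+ ((con 1 :+ α) :* W :+ β :* Y)) refl

  absorb-other : ∀ Y C α W β → Y + (C + (α * W + β * Y)) ≡ C + (α * W + suc β * Y)
  absorb-other = solve 5 (λ Y C α W β → Y :+ (C :+ (α :* W :+ β :* Y)) := C :+ (α :* W :+ (con 1 :+ β) :* Y)) refl

  rebalance : ∀ k α′ β′ V Z W Y → W + Y ≡ V + Z →
    k * V + (k * Z + (α′ * W + β′ * Y)) ≡ (k + α′) * W + (k + β′) * Y
  rebalance k α′ β′ V Z W Y W+Y≡V+Z = begin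
    k * V + (k * Z + (α′ * W + β′ * Y))
      ≡⟨ solve 7 (λ k α′ β′ V Z W Y → k :* V :+ (k :* Z :+ (α′ :* W :+ β′ :* Y))
                                     := k :* (V :+ Z) :+ (α′ :* W :+ β′ :* Y)) refl k α′ β′ V Z W Y ⟩
    k * (V + Z) + (α′ * W + β′ * Y)
      ≡⟨ cong (λ s → k * s + (α′ * W + β′ * Y)) (sym W+Y≡V+Z) ⟩
    k * (W + Y) + (α′ * W + β′ * Y)
      ≡⟨ solve 5 (λ k α′ β′ W Y → k :* (W :+ Y) :+ (α′ :* W :+ β′ :* Y)
                                 := (k :+ α′) :* W :+ (k :+ β′) :* Y) refl k α′ β′ W Y ⟩
    (k + α′) * W + (k + β′) * Y
      ∎
    where open ≡-Reasoning

module MaximalChain {n} {D : Domain n} (chain : SingleCrossingChain D) (maximal : IsMaximalCondorcet D) where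

  open SingleCrossingChain chain

  private
    D-linear : All IsLinOrder D
    D-linear = proj₁ (proj₁ maximal)

    lin : AllLinear f m
    lin = linear-at

  condorcet-extension-in-chain : ∀ {w} → IsCondorcet (w ∷ D) → InRange f m w
  condorcet-extension-in-chain {w} condorcet = complete (proj₂ maximal (w ∷ D) condorcet (λ _ → there) w (here refl))

  chain-extension-in-chain : ∀ {w g m′} → Linear w → AllLinear g m′ → Convex g m′ →
    (∀ {v} → v ∈ w ∷ D → InRange g m′ v) → InRange f m w
  chain-extension-in-chain lin-w lin-g convex-g covers =
    condorcet-extension-in-chain (chain-condorcet lin-g convex-g (lookup-injective lin-w ∷ D-linear) covers)

  prepend-covers : ∀ {w v} → v ∈ w ∷ D → InRange (w ◅ f) (suc m) v
  prepend-covers (here refl) = 0 , s≤s z≤n , refl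
  prepend-covers (there v∈D) = let i , i<m , f[i]≡v = complete v∈D in suc i , s≤s i<m , f[i]≡v

  nonempty : 0 < m
  nonempty = ℕₚ.≰⇒> λ m≤0 →
    let below-0 = λ {k} (k<m : k < m) → ℕₚ.n≮0 (ℕₚ.<-≤-trans k<m m≤0)
        i , i<m , _ = chain-extension-in-chain allFin-linear (prepend-linear lin convex allFin-linear)
                        (prepend-convex lin convex (⊥-elim ∘ below-0)) prepend-covers
    in below-0 i<m

  last : ℕ
  last = pred m

  last<m : last < m
  last<m = ℕₚ.m≤pred[n]⇒suc[m]≤n {{>-nonZero nonempty}} ℕₚ.≤-refl

  -- Otherwise swapping that pair in f 0 gives an order that can be put in front of the chain.
  ends-disagree-on-adjacent : ∀ {r r′} → Adjacent r r′ → ¬ Prefers (f last) (lookup (f 0) r) (lookup (f 0) r′)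
  ends-disagree-on-adjacent {r} {r′} r⋖r′ u-r≻r′ =
    w∉chain (chain-extension-in-chain lin-w (prepend-linear lin convex lin-w) (prepend-convex lin convex w-before)
                                      prepend-covers)
    where
    v : Order n
    v = f 0
    lin-v : Linear v
    lin-v = lin nonempty
    v-r≻r′ : Prefers v (lookup v r) (lookup v r′)
    v-r≻r′ = prefers-lookup v (adjacent-< r⋖r′)
    all-r≻r′ : ∀ {k} → k < m → Prefers (f k) (lookup v r) (lookup v r′)
    all-r≻r′ k<m = convex z≤n (ℕₚ.<⇒≤pred k<m) last<m v-r≻r′ u-r≻r′
    w : Order n
    w = swap r r′ v
    lin-w : Linear w
    lin-w = swap-linear lin-v
    w-before : ∀ {k} → k < m → Between w (f 0) (f k)
    w-before k<m {c} {d} w-c≻d k-c≻d with same-pair? (lookup v r) (lookup v r′) c d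
    ... | yes (inj₁ (refl , refl)) = ⊥-elim (prefers-asym lin-w w-c≻d (swap-reverses {v = v} r⋖r′))
    ... | yes (inj₂ (refl , refl)) = ⊥-elim (prefers-asym (lin k<m) k-c≻d (all-r≻r′ k<m))
    ... | no other-pair = swap-reflects {v = v} r⋖r′ other-pair w-c≻d
    w∉chain : ¬ InRange f m w
    w∉chain (k , k<m , f[k]≡w) = prefers-asym lin-w (prefers-≡ f[k]≡w (all-r≻r′ k<m)) (swap-reverses {v = v} r⋖r′)

  ends-reversed : ∀ {a b} → Prefers (f 0) a b → Prefers (f last) b a
  ends-reversed (p , q , p<q , refl , refl) with prefers? (f last) (lookup (f 0) q) (lookup (f 0) p)
  ... | yes last-b≻a = last-b≻a
  ... | no last-b⊁a =
    let lin-u = lin last<m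
        r , r′ , r⋖r′ , u-r′⊁r = adjacent-witness (f 0) (λ x y → prefers? (f last) y x)
                                   (λ y≻x z≻y → prefers-trans lin-u z≻y y≻x) p<q last-b⊁a
        v[r]≢v[r′] = prefers⇒≢ (lin nonempty) (prefers-lookup (f 0) (adjacent-< r⋖r′))
    in ⊥-elim (ends-disagree-on-adjacent r⋖r′ (¬prefers⇒prefers lin-u (v[r]≢v[r′] ∘ sym) u-r′⊁r))

  -- Otherwise swap r r′ (f i) can be inserted between f i and f (suc i).
  reversed-adjacent-pair-is-step : ∀ {i r r′} → suc i < m → Adjacent r r′ →
    Prefers (f (suc i)) (lookup (f i) r′) (lookup (f i) r) → f (suc i) ≡ swap r r′ (f i)
  reversed-adjacent-pair-is-step {i} {r} {r′} 1+i<m r⋖r′ u-r′≻r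
    with Vecₚ.≡-dec Finₚ._≟_ (f (suc i)) (swap r r′ (f i))
  ... | yes u≡w = u≡w
  ... | no u≢w = ⊥-elim (w∉chain (chain-extension-in-chain lin-w (insert-linear lin convex 1+i<m lin-w w-between)
                                     (insert-convex lin convex 1+i<m lin-w w-between) covers))
    where
    v u w : Order n
    v = f i
    u = f (suc i)
    w = swap r r′ v
    lin-v : Linear v
    lin-v = lin (ℕₚ.<-trans (ℕₚ.n<1+n i) 1+i<m)
    lin-u : Linear u
    lin-u = lin 1+i<m
    lin-w : Linear w
    lin-w = swap-linear lin-v
    v-r≻r′ : Prefers v (lookup v r) (lookup v r′)
    v-r≻r′ = prefers-lookup v (adjacent-< r⋖r′)
    w-r′≻r : Prefers w (lookup v r′) (lookup v r)
    w-r′≻r = swap-reverses {v = v} r⋖r′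
    w-between : Between v w u
    w-between {c} {d} v-c≻d u-c≻d with same-pair? (lookup v r) (lookup v r′) c d
    ... | yes (inj₁ (refl , refl)) = ⊥-elim (prefers-asym lin-u u-c≻d u-r′≻r)
    ... | yes (inj₂ (refl , refl)) = ⊥-elim (prefers-asym lin-v v-c≻d v-r≻r′)
    ... | no other-pair = swap-preserves {v = v} r⋖r′ other-pair v-c≻d
    covers : ∀ {x} → x ∈ w ∷ D → InRange (splice (skip (suc i)) (suc i) w f) (suc m) x
    covers (here refl) = suc i , ℕₚ.m<n⇒m<1+n 1+i<m , splice-at (skip (suc i)) (suc i) w f
    covers (there x∈D) = insert-covers (complete x∈D)
    w∉chain : ¬ InRange f m w
    w∉chain (k , k<m , f[k]≡w) with k ≤? i
    ... | yes k≤i =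
      prefers-asym lin-w
        (prefers-≡ f[k]≡w (prefers-before-reversal lin convex (ℕₚ.n≤1+n i) 1+i<m v-r≻r′ u-r′≻r k≤i)) w-r′≻r
    ... | no k≰i with disagreement lin-w lin-u (u≢w ∘ sym)
    ...   | c , d , w-c≻d , u-d≻c with same-pair? (lookup v r) (lookup v r′) c d
    ...     | yes (inj₁ (refl , refl)) = prefers-asym lin-w w-c≻d w-r′≻r
    ...     | yes (inj₂ (refl , refl)) = prefers-asym lin-u u-d≻c u-r′≻r
    ...     | no other-pair = prefers-asym lin-w w-c≻d
      (prefers-≡ f[k]≡w (prefers-after-reversal lin convex (ℕₚ.n≤1+n i) (swap-reflects {v = v} r⋖r′ other-pair w-c≻d)
                                                u-d≻c (ℕₚ.≰⇒> k≰i) k<m))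

  step-is-adjacent-swap : ∀ {i} → suc i < m → ∃[ r ] ∃[ r′ ] (Adjacent r r′ × f (suc i) ≡ swap r r′ (f i))
  step-is-adjacent-swap {i} 1+i<m = from-inversion (proj₂ (proj₂ (disagreement lin-v lin-u v≢u)))
    where
    i<m : i < m
    i<m = ℕₚ.<-trans (ℕₚ.n<1+n i) 1+i<m
    v u : Order n
    v = f i
    u = f (suc i)
    lin-v : Linear v
    lin-v = lin i<m
    lin-u : Linear u
    lin-u = lin 1+i<m
    v≢u : v ≢ u
    v≢u e = ℕₚ.1+n≢n (sym (injective i<m 1+i<m e))
    from-inversion : ∀ {c d} → Prefers v c d × Prefers u d c → ∃[ r ] ∃[ r′ ] (Adjacent r r′ × u ≡ swap r r′ v)
    from-inversion ((p , q , p<q , refl , refl) , u-q≻p) =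
      let r , r′ , r⋖r′ , u-r⊁r′ =
            adjacent-witness v (prefers? u) (prefers-trans lin-u) p<q (prefers-asym lin-u u-q≻p)
          v[r]≢v[r′] = prefers⇒≢ lin-v (prefers-lookup v (adjacent-< r⋖r′))
      in r , r′ , r⋖r′ , reversed-adjacent-pair-is-step 1+i<m r⋖r′ (¬prefers⇒prefers lin-u v[r]≢v[r′] u-r⊁r′)

  private
    ⟦_⟧ : Order n → Fin n → Fin n → ℕ
    ⟦ u ⟧ = count (u ∷ [])

    swap-agrees : ∀ {u r r′ c d} (x : Order n) → u ≡ swap r r′ x → Adjacent r r′ →
      ¬ SamePair (lookup x r) (lookup x r′) c d →
      Prefers u c d ⇔ Prefers x c d
    swap-agrees x refl r⋖r′ other-pair =
      mk⇔ (swap-reflects {v = x} r⋖r′ other-pair) (swap-preserves {v = x} r⋖r′ other-pair)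

  module _ {t p p′ q q′} (2+t<m : suc (suc t) < m) (p⋖p′ : Adjacent p p′) (q⋖q′ : Adjacent q q′)
    (p≢q : p ≢ q) (p≢q′ : p ≢ q′) (p′≢q : p′ ≢ q) (p′≢q′ : p′ ≢ q′)
    (y≡ : f (suc t) ≡ swap p p′ (f t)) (z≡ : f (suc (suc t)) ≡ swap q q′ (f (suc t))) where

    private
      1+t<m : suc t < m
      1+t<m = ℕₚ.<-trans (ℕₚ.n<1+n (suc t)) 2+t<m
      t<m : t < m
      t<m = ℕₚ.<-trans (ℕₚ.n<1+n t) 1+t<m
      v y z w : Order n
      v = f t
      y = f (suc t)
      z = f (suc (suc t))
      w = swap q q′ v
      lin-v : Linear v
      lin-v = lin t<m
      lin-w : Linear w
      lin-w = swap-linear lin-v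

      v-injective : ∀ {i j} → lookup v i ≡ lookup v j → i ≡ j
      v-injective = lookup-injective lin-v _ _

      z≡′ : z ≡ swap p p′ w
      z≡′ = trans z≡ (trans (cong (swap q q′) y≡) (swap-comm p≢q p≢q′ p′≢q p′≢q′ v))

      w[p] : lookup w p ≡ lookup v p
      w[p] = lookup-swap-other {v = v} p≢q p≢q′
      w[p′] : lookup w p′ ≡ lookup v p′
      w[p′] = lookup-swap-other {v = v} p′≢q p′≢q′
      y[q] : lookup y q ≡ lookup v q
      y[q] = trans (cong (λ x → lookup x q) y≡) (lookup-swap-other {v = v} (p≢q ∘ sym) (p′≢q ∘ sym))
      y[q′] : lookup y q′ ≡ lookup v q′
      y[q′] = trans (cong (λ x → lookup x q′) y≡) (lookup-swap-other {v = v} (p≢q′ ∘ sym) (p′≢q′ ∘ sym))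

      P-pair Q-pair : Fin n → Fin n → Set
      P-pair = SamePair (lookup v p) (lookup v p′)
      Q-pair = SamePair (lookup v q) (lookup v q′)

      off-P : ∀ {c d} → ¬ P-pair c d → (Prefers y c d ⇔ Prefers v c d) × (Prefers z c d ⇔ Prefers w c d)
      off-P {c} {d} ¬P = swap-agrees v y≡ p⋖p′ ¬P ,
                 swap-agrees w z≡′ p⋖p′ (subst₂ (λ x x′ → ¬ SamePair x x′ c d)
                   (sym w[p]) (sym w[p′]) ¬P)

      off-Q : ∀ {c d} → ¬ Q-pair c d → (Prefers w c d ⇔ Prefers v c d) × (Prefers z c d ⇔ Prefers y c d)
      off-Q {c} {d} ¬Q = swap-agrees v refl q⋖q′ ¬Q ,
                 swap-agrees y z≡ q⋖q′ (subst₂ (λ x x′ → ¬ SamePair x x′ c d)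
                   (sym y[q]) (sym y[q′]) ¬Q)

      one-pair-untouched : ∀ c d → ¬ P-pair c d ⊎ ¬ Q-pair c d
      one-pair-untouched c d with same-pair? (lookup v p) (lookup v p′) c d
      ... | no ¬P = inj₁ ¬P
      ... | yes (inj₁ (refl , refl)) =
        inj₂ λ { (inj₁ (e , _)) → p≢q (v-injective e) ; (inj₂ (e , _)) → p≢q′ (v-injective e) }
      ... | yes (inj₂ (refl , refl)) =
        inj₂ λ { (inj₁ (e , _)) → p′≢q (v-injective e) ; (inj₂ (e , _)) → p′≢q′ (v-injective e) }

      w-between : Between v w z
      w-between {c} {d} v-c≻d z-c≻d with one-pair-untouched c d
      ... | inj₁ ¬P = to (proj₂ (off-P ¬P)) z-c≻d
      ... | inj₂ ¬Q = from (proj₁ (off-Q ¬Q)) v-c≻d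

      balance : ∀ a b → ⟦ w ⟧ a b + ⟦ y ⟧ a b ≡ ⟦ v ⟧ a b + ⟦ z ⟧ a b
      balance a b with one-pair-untouched a b
      ... | inj₁ ¬P =
        let y~v , z~w = off-P {a} {b} ¬P
        in trans (cong (⟦ w ⟧ a b +_) (count-singleton-cong {u = y} {v} {a} {b} (to y~v) (from y~v)))
                 (trans (ℕₚ.+-comm (⟦ w ⟧ a b) (⟦ v ⟧ a b))
                        (cong (⟦ v ⟧ a b +_) (count-singleton-cong {u = w} {z} {a} {b} (from z~w) (to z~w))))
      ... | inj₂ ¬Q =
        let w~v , z~y = off-Q {a} {b} ¬Q
        in cong₂ _+_ (count-singleton-cong {u = w} {v} {a} {b} (to w~v) (from w~v))
                     (count-singleton-cong {u = y} {z} {a} {b} (from z~y) (to z~y))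

      w∉chain : ¬ InRange f m w
      w∉chain (k , k<m , f[k]≡w) with k ≤? suc t
      ... | yes k≤1+t = prefers-asym lin-w
              (prefers-≡ f[k]≡w (prefers-before-reversal lin convex (ℕₚ.n≤1+n _) 2+t<m y-q≻q′ z-q′≻q k≤1+t))
              (swap-reverses {v = v} q⋖q′)
        where
        y-q≻q′ : Prefers y (lookup v q) (lookup v q′)
        y-q≻q′ = q , q′ , adjacent-< q⋖q′ , y[q] , y[q′]
        z-q′≻q : Prefers z (lookup v q′) (lookup v q)
        z-q′≻q = subst₂ (Prefers z) y[q′] y[q] (prefers-≡ (sym z≡) (swap-reverses {v = y} q⋖q′))
      ... | no k≰1+t = prefers-asym lin-w
              w-p≻p′
              (prefers-≡ f[k]≡w (prefers-after-reversal lin convex (ℕₚ.n≤1+n _) v-p≻p′ y-p′≻p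
                                                        (ℕₚ.<⇒≤ (ℕₚ.≰⇒> k≰1+t)) k<m))
        where
        v-p≻p′ : Prefers v (lookup v p) (lookup v p′)
        v-p≻p′ = prefers-lookup v (adjacent-< p⋖p′)
        y-p′≻p : Prefers y (lookup v p′) (lookup v p)
        y-p′≻p = prefers-≡ (sym y≡) (swap-reverses {v = v} p⋖p′)
        w-p≻p′ : Prefers w (lookup v p) (lookup v p′)
        w-p≻p′ = p , p′ , adjacent-< p⋖p′ , w[p] , w[p′]

      Counts : List (Order n) → List (Order n) → ℕ → ℕ → Set
      Counts P P₀ α β = ∀ a b → count P a b ≡ count P₀ a b + (α * ⟦ w ⟧ a b + β * ⟦ y ⟧ a b)

      separate : ∀ {P} → All (_∈ w ∷ D) P →
        ∃[ P₀ ] ∃[ α ] ∃[ β ] (All (λ u → u ∈ D × u ≢ y) P₀ × Counts P P₀ α β)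
      separate [] = [] , 0 , 0 , [] , λ _ _ → refl
      separate {u ∷ P} (u∈ ∷ rest) with separate rest | Vecₚ.≡-dec Finₚ._≟_ u w | Vecₚ.≡-dec Finₚ._≟_ u y
      ... | P₀ , α , β , P₀-ok , counts | yes refl | _ = P₀ , suc α , β , P₀-ok , λ a b →
        trans (count-++ (w ∷ []) P a b)
          (trans (cong (⟦ w ⟧ a b +_) (counts a b)) (absorb-one (⟦ w ⟧ a b) (count P₀ a b) α (⟦ y ⟧ a b) β))
      ... | P₀ , α , β , P₀-ok , counts | no _ | yes refl = P₀ , α , suc β , P₀-ok , λ a b →
        trans (count-++ (y ∷ []) P a b)
          (trans (cong (⟦ y ⟧ a b +_) (counts a b)) (absorb-other (⟦ y ⟧ a b) (count P₀ a b) α (⟦ w ⟧ a b) β))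
      ... | P₀ , α , β , P₀-ok , counts | no u≢w | no u≢y = u ∷ P₀ , α , β , (in-D u∈ , u≢y) ∷ P₀-ok , λ a b →
        trans (count-++ (u ∷ []) P a b) (trans (cong (⟦ u ⟧ a b +_) (counts a b))
          (trans (sym (ℕₚ.+-assoc (⟦ u ⟧ a b) _ _)) (cong (_+ _) (sym (count-++ (u ∷ []) P₀ a b)))))
        where
        in-D : u ∈ w ∷ D → u ∈ D
        in-D (here u≡w) = ⊥-elim (u≢w u≡w)
        in-D (there u∈D) = u∈D

      rebalanced-profile : List (Order n) → ℕ → ℕ → ℕ → List (Order n)
      rebalanced-profile P₀ k α′ β′ = P₀ ++ replicate k v ++ replicate k z ++ replicate α′ w ++ replicate β′ y

      rebalanced : ∀ P₀ k α′ β′ → Counts (rebalanced-profile P₀ k α′ β′) P₀ (k + α′) (k + β′)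
      rebalanced P₀ k α′ β′ a b = begin
        count (rebalanced-profile P₀ k α′ β′) a b
          ≡⟨ count-++ P₀ _ a b ⟩
        count P₀ a b + count (replicate k v ++ replicate k z ++ replicate α′ w ++ replicate β′ y) a b
          ≡⟨ cong (count P₀ a b +_) (trans (count-++ (replicate k v) _ a b) (cong₂ _+_ (count-replicate k v a b)
               (trans (count-++ (replicate k z) _ a b) (cong₂ _+_ (count-replicate k z a b)
                 (trans (count-++ (replicate α′ w) _ a b)
                        (cong₂ _+_ (count-replicate α′ w a b) (count-replicate β′ y a b))))))) ⟩
        count P₀ a b + (k * ⟦ v ⟧ a b + (k * ⟦ z ⟧ a b + (α′ * ⟦ w ⟧ a b + β′ * ⟦ y ⟧ a b)))
          ≡⟨ cong (count P₀ a b +_)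
                  (rebalance k α′ β′ (⟦ v ⟧ a b) (⟦ z ⟧ a b) (⟦ w ⟧ a b) (⟦ y ⟧ a b) (balance a b)) ⟩
        count P₀ a b + ((k + α′) * ⟦ w ⟧ a b + (k + β′) * ⟦ y ⟧ a b)
          ∎
        where open ≡-Reasoning

      same-counts : ∀ {P P₀ α β} k α′ β′ → Counts P P₀ α β → k + α′ ≡ α → k + β′ ≡ β →
        ∀ a b → count P a b ≡ count (rebalanced-profile P₀ k α′ β′) a b
      same-counts {P₀ = P₀} k α′ β′ counts refl refl a b = trans (counts a b) (sym (rebalanced P₀ k α′ β′ a b))

      -- Trading each pair (w, y) of voters for (v, z) leaves only copies of y or only copies of w besides
      -- voters of D ∖ {y}: a profile on the chain f, or on f with y replaced by w.
      dominated : ∀ {P} → All (_∈ w ∷ D) P → Dominated P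
      dominated {P} P-ok = from-separation (separate P-ok)
        where
        from-separation : ∃[ P₀ ] ∃[ α ] ∃[ β ] (All (λ u → u ∈ D × u ≢ y) P₀ × Counts P P₀ α β) → Dominated P
        from-separation (P₀ , α , β , P₀-ok , counts) = [ more-y , more-w ] (ℕₚ.≤-total α β)
          where
          more-y : α ≤ β → Dominated P
          more-y α≤β =
            dominated-by-counts {P = P} {Q = rebalanced-profile P₀ α 0 (β ∸ α)}
              (same-counts {P = P} {P₀ = P₀} α 0 (β ∸ α) counts (ℕₚ.+-identityʳ α) (ℕₚ.m+[n∸m]≡n α≤β))
              (chain-profile-dominated lin convex on-chain)
            where
            on-chain : All (InRange f m) (rebalanced-profile P₀ α 0 (β ∸ α))
            on-chain = AllP.++⁺ (All.map (complete ∘ proj₁) P₀-ok)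
                         (AllP.++⁺ (AllP.replicate⁺ α (t , t<m , refl))
                           (AllP.++⁺ (AllP.replicate⁺ α (suc (suc t) , 2+t<m , refl))
                             (AllP.replicate⁺ (β ∸ α) (suc t , 1+t<m , refl))))

          more-w : β ≤ α → Dominated P
          more-w β≤α =
            dominated-by-counts {P = P} {Q = rebalanced-profile P₀ β (α ∸ β) 0}
              (same-counts {P = P} {P₀ = P₀} β (α ∸ β) 0 counts (ℕₚ.m+[n∸m]≡n β≤α) (ℕₚ.+-identityʳ β))
              (chain-profile-dominated (replace-linear lin convex 2+t<m lin-w w-between)
                                       (replace-convex lin convex 2+t<m lin-w w-between) on-chain)
            where
            v≢y : v ≢ y
            v≢y = ℕₚ.1+n≢n ∘ sym ∘ injective t<m 1+t<m
            z≢y : z ≢ y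
            z≢y = ℕₚ.1+n≢n ∘ injective 2+t<m 1+t<m
            on-chain : All (InRange (splice id (suc t) w f) m) (rebalanced-profile P₀ β (α ∸ β) 0)
            on-chain = AllP.++⁺ (All.map (λ { (u∈D , u≢y) → replace-covers (complete u∈D) u≢y }) P₀-ok)
                         (AllP.++⁺ (AllP.replicate⁺ β (replace-covers (t , t<m , refl) v≢y))
                           (AllP.++⁺ (AllP.replicate⁺ β (replace-covers (suc (suc t) , 2+t<m , refl) z≢y))
                             (AllP.++⁺ (AllP.replicate⁺ (α ∸ β) (suc t , 1+t<m , splice-at id (suc t) w f)) [])))

    -- Disjoint transpositions commute, so the fourth corner w of the square lies between f t and
    -- f (t + 2); it is not in the chain, but adding it keeps the domain Condorcet.
    no-commuting-square : ⊥
    no-commuting-square = w∉chain (condorcet-extension-in-chain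
      ((lookup-injective lin-w ∷ D-linear) , λ P P-ok → dominated⇒acyclic {P = P} (dominated P-ok)))

  consecutive-swaps-overlap : ∀ {t p p′ q q′} → suc (suc t) < m → Adjacent p p′ → Adjacent q q′ →
    f (suc t) ≡ swap p p′ (f t) → f (suc (suc t)) ≡ swap q q′ (f (suc t)) →
    toℕ q ≡ suc (toℕ p) ⊎ toℕ p ≡ suc (toℕ q)
  consecutive-swaps-overlap {t} {p} {p′} {q} {q′} 2+t<m p⋖p′ q⋖q′ y≡ z≡ =
    by-cases (toℕ q ≟ suc (toℕ p)) (toℕ p ≟ suc (toℕ q)) (p Finₚ.≟ q)
    where
    swap-undone : p ≢ q
    swap-undone p≡q = ℕₚ.<⇒≢ (ℕₚ.<-trans (ℕₚ.n<1+n t) (ℕₚ.n<1+n (suc t))) (sym (injective 2+t<m t<m z≡v))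
      where
      t<m : t < m
      t<m = ℕₚ.<-trans (ℕₚ.n<1+n t) (ℕₚ.<-trans (ℕₚ.n<1+n (suc t)) 2+t<m)
      p′≡q′ : p′ ≡ q′
      p′≡q′ = Finₚ.toℕ-injective (trans p⋖p′ (trans (cong (suc ∘ toℕ) p≡q) (sym q⋖q′)))
      z≡v : f (suc (suc t)) ≡ f t
      z≡v = trans z≡ (trans (cong₂ (λ r r′ → swap r r′ (f (suc t))) (sym p≡q) (sym p′≡q′))
                            (trans (cong (swap p p′) y≡) swap-involutive))
    by-cases : Dec (toℕ q ≡ suc (toℕ p)) → Dec (toℕ p ≡ suc (toℕ q)) → Dec (p ≡ q) →
      toℕ q ≡ suc (toℕ p) ⊎ toℕ p ≡ suc (toℕ q)
    by-cases (yes q≡1+p) _ _ = inj₁ q≡1+p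
    by-cases (no _) (yes p≡1+q) _ = inj₂ p≡1+q
    by-cases (no _) (no _) (yes p≡q) = ⊥-elim (swap-undone p≡q)
    by-cases (no q≢1+p) (no p≢1+q) (no p≢q) =
      ⊥-elim (no-commuting-square 2+t<m p⋖p′ q⋖q′ p≢q p≢q′ p′≢q p′≢q′ y≡ z≡)
      where
      p≢q′ : p ≢ q′
      p≢q′ e = p≢1+q (trans (cong toℕ e) q⋖q′)
      p′≢q : p′ ≢ q
      p′≢q e = q≢1+p (trans (cong toℕ (sym e)) p⋖p′)
      p′≢q′ : p′ ≢ q′
      p′≢q′ e = p≢q (Finₚ.toℕ-injective (ℕₚ.suc-injective (trans (sym p⋖p′) (trans (cong toℕ e) q⋖q′))))

-- Neighbours on a circle

CyclicSucc : ℕ → ℕ → ℕ → Set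
CyclicSucc n a b = b ≡ suc a ⊎ (suc a ≡ n × b ≡ 0)

cyclic-succ-functional : ∀ {n a b b′} → b < n → b′ < n → CyclicSucc n a b → CyclicSucc n a b′ → b ≡ b′
cyclic-succ-functional _ _ (inj₁ refl) (inj₁ refl) = refl
cyclic-succ-functional b<n _ (inj₁ refl) (inj₂ (1+a≡n , _)) = ⊥-elim (ℕₚ.<⇒≢ b<n 1+a≡n)
cyclic-succ-functional _ b′<n (inj₂ (1+a≡n , _)) (inj₁ refl) = ⊥-elim (ℕₚ.<⇒≢ b′<n 1+a≡n)
cyclic-succ-functional _ _ (inj₂ (_ , refl)) (inj₂ (_ , refl)) = refl

cyclic-succ-injective : ∀ {n a a′ b} → CyclicSucc n a b → CyclicSucc n a′ b → a ≡ a′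
cyclic-succ-injective (inj₁ refl) (inj₁ e) = ℕₚ.suc-injective e
cyclic-succ-injective (inj₁ refl) (inj₂ (_ , ()))
cyclic-succ-injective (inj₂ (_ , refl)) (inj₁ ())
cyclic-succ-injective (inj₂ (1+a≡n , _)) (inj₂ (1+a′≡n , _)) = ℕₚ.suc-injective (trans 1+a≡n (sym 1+a′≡n))

cyclic-succ-irrefl : ∀ {n a} → 2 ≤ n → ¬ CyclicSucc n a a
cyclic-succ-irrefl _ (inj₁ a≡1+a) = ℕₚ.1+n≢n (sym a≡1+a)
cyclic-succ-irrefl 2≤n (inj₂ (1≡n , refl)) = ℕₚ.<⇒≱ (subst (_< 2) 1≡n (s<s z<s)) 2≤n

private
  length-at-most-3 : ∀ {k n} → k < 4 → k ≡ n → ¬ 4 ≤ n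
  length-at-most-3 k<4 refl = ℕₚ.<⇒≱ k<4

no-cyclic-3-cycle : ∀ {n a b c} → 4 ≤ n → CyclicSucc n a b → CyclicSucc n b c → CyclicSucc n c a → ⊥
no-cyclic-3-cycle {a = a} _ (inj₁ refl) (inj₁ refl) (inj₁ e) = ℕₚ.m≢1+n+m a {2} e
no-cyclic-3-cycle 4≤n (inj₁ refl) (inj₁ refl) (inj₂ (e , refl)) = length-at-most-3 (s<s (s<s (s<s z<s))) e 4≤n
no-cyclic-3-cycle 4≤n (inj₁ refl) (inj₂ (e , refl)) (inj₁ refl) = length-at-most-3 (s<s (s<s (s<s z<s))) e 4≤n
no-cyclic-3-cycle 4≤n (inj₁ refl) (inj₂ (_ , refl)) (inj₂ (e , _)) = length-at-most-3 (s<s z<s) e 4≤n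
no-cyclic-3-cycle 4≤n (inj₂ (e , refl)) (inj₁ refl) (inj₁ refl) = length-at-most-3 (s<s (s<s (s<s z<s))) e 4≤n
no-cyclic-3-cycle 4≤n (inj₂ (_ , refl)) (inj₁ refl) (inj₂ (e , _)) = length-at-most-3 (s<s (s<s z<s)) e 4≤n
no-cyclic-3-cycle 4≤n (inj₂ (_ , refl)) (inj₂ (e , _)) _ = length-at-most-3 (s<s z<s) e 4≤n

CyclicallyAdjacent : ℕ → ℕ → ℕ → Set
CyclicallyAdjacent n a b = CyclicSucc n a b ⊎ CyclicSucc n b a

no-cyclic-triangle : ∀ {n x y z} → 4 ≤ n → x < n → y < n → z < n → x ≢ y → x ≢ z → y ≢ z →
  CyclicallyAdjacent n x y → CyclicallyAdjacent n x z → CyclicallyAdjacent n y z → ⊥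
no-cyclic-triangle _ _ y<n z<n _ _ y≢z (inj₁ x→y) (inj₁ x→z) _ = y≢z (cyclic-succ-functional y<n z<n x→y x→z)
no-cyclic-triangle _ _ _ _ _ _ y≢z (inj₂ y→x) (inj₂ z→x) _ = y≢z (cyclic-succ-injective y→x z→x)
no-cyclic-triangle 4≤n _ _ _ _ _ _ (inj₁ x→y) (inj₂ z→x) (inj₁ y→z) = no-cyclic-3-cycle 4≤n x→y y→z z→x
no-cyclic-triangle _ x<n y<n _ x≢y _ _ (inj₁ _) (inj₂ z→x) (inj₂ z→y) = x≢y (cyclic-succ-functional x<n y<n z→x z→y)
no-cyclic-triangle _ x<n _ z<n _ x≢z _ (inj₂ y→x) (inj₁ _) (inj₁ y→z) = x≢z (cyclic-succ-functional x<n z<n y→x y→z)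
no-cyclic-triangle 4≤n _ _ _ _ _ _ (inj₂ y→x) (inj₁ x→z) (inj₂ z→y) = no-cyclic-3-cycle 4≤n x→z z→y y→x

data Neighbours {n} (c : Order n) (x y : Fin n) : Set where
  neighbours : ∀ j j′ → CyclicSucc n (toℕ j) (toℕ j′) → SamePair (lookup c j) (lookup c j′) x y → Neighbours c x y

neighbours-sym : ∀ {n} {c : Order n} {x y} → Neighbours c x y → Neighbours c y x
neighbours-sym (neighbours j j′ j→j′ (inj₁ (x≡ , y≡))) = neighbours j j′ j→j′ (inj₂ (y≡ , x≡))
neighbours-sym (neighbours j j′ j→j′ (inj₂ (x≡ , y≡))) = neighbours j j′ j→j′ (inj₁ (y≡ , x≡))

module _ {n} {c : Order n} (lin-c : Linear c) where

  private
    position : Fin n → Fin n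
    position x = proj₁ (lookup-surjective lin-c x)

    position-unique : ∀ {x j} → x ≡ lookup c j → j ≡ position x
    position-unique {x} x≡c[j] = lookup-injective lin-c _ _ (trans (sym x≡c[j]) (sym (proj₂ (lookup-surjective lin-c x))))

    neighbour-positions : ∀ {x y} → Neighbours c x y → CyclicallyAdjacent n (toℕ (position x)) (toℕ (position y))
    neighbour-positions (neighbours _ _ j→j′ (inj₁ (x≡ , y≡))) =
      inj₁ (subst₂ (CyclicSucc n) (cong toℕ (position-unique x≡)) (cong toℕ (position-unique y≡)) j→j′)
    neighbour-positions (neighbours _ _ j→j′ (inj₂ (x≡ , y≡))) =
      inj₂ (subst₂ (CyclicSucc n) (cong toℕ (position-unique y≡)) (cong toℕ (position-unique x≡)) j→j′)

    distinct-positions : ∀ {x y} → x ≢ y → toℕ (position x) ≢ toℕ (position y)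
    distinct-positions {x} {y} x≢y e = x≢y (trans (sym (proj₂ (lookup-surjective lin-c x)))
      (trans (cong (lookup c) (Finₚ.toℕ-injective e)) (proj₂ (lookup-surjective lin-c y))))

  no-neighbour-triangle : 4 ≤ n → ∀ {x y z} → x ≢ y → x ≢ z → y ≢ z →
    Neighbours c x y → Neighbours c x z → Neighbours c y z → ⊥
  no-neighbour-triangle 4≤n x≢y x≢z y≢z xy xz yz =
    no-cyclic-triangle 4≤n (Finₚ.toℕ<n _) (Finₚ.toℕ<n _) (Finₚ.toℕ<n _)
      (distinct-positions x≢y) (distinct-positions x≢z) (distinct-positions y≢z)
      (neighbour-positions xy) (neighbour-positions xz) (neighbour-positions yz)

  -- The first two positions s and s + 1 of a two-element arc carry both of its elements.
  two-element-arc : 2 ≤ n → ∀ {S : Fin n → Set} {x y} → x ≢ y → IsArc c S → (∀ {b} → S b → b ≡ x ⊎ b ≡ y) →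
    S x → S y → Neighbours c x y
  two-element-arc 2≤n {S} {x} {y} x≢y (s , ℓ , _ , S⇔) only-x-y Sx Sy =
    first-two-positions (only-x-y (from (S⇔ _) (0 , s , 0<ℓ , inj₁ (sym (ℕₚ.+-identityʳ _)) , refl)))
                        (only-x-y (from (S⇔ _) (1 , next , 1<ℓ , next-at-1 , refl)))
    where
    ArcPosition : ℕ → Fin n → Set
    ArcPosition i j = toℕ j ≡ toℕ s + i ⊎ toℕ j + n ≡ toℕ s + i

    at-start : ∀ {j} → ArcPosition 0 j → j ≡ s
    at-start (inj₁ e) = Finₚ.toℕ-injective (trans e (ℕₚ.+-identityʳ _))
    at-start {j} (inj₂ e) =
      ⊥-elim (ℕₚ.<⇒≱ (Finₚ.toℕ<n s) (subst (n ≤_) (trans e (ℕₚ.+-identityʳ _)) (ℕₚ.m≤n+m n (toℕ j))))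

    1<ℓ : 1 < ℓ
    1<ℓ = ℕₚ.≰⇒> λ ℓ≤1 →
      let start : ∀ {b} → S b → b ≡ lookup c s
          start Sb = let i , j , i<ℓ , at-i , b≡c[j] = to (S⇔ _) Sb
                         i≡0 = ℕₚ.n<1⇒n≡0 (ℕₚ.<-≤-trans i<ℓ ℓ≤1)
                     in trans b≡c[j] (cong (lookup c) (at-start (subst (λ i → ArcPosition i j) i≡0 at-i)))
      in x≢y (trans (start Sx) (sym (start Sy)))

    0<ℓ : 0 < ℓ
    0<ℓ = ℕₚ.<-trans (s≤s z≤n) 1<ℓ

    next-exists : ∃[ s′ ] (ArcPosition 1 s′ × CyclicSucc n (toℕ s) (toℕ s′))
    next-exists with suc (toℕ s) <? n
    ... | yes 1+s<n =
      fromℕ< 1+s<n , inj₁ (trans (Finₚ.toℕ-fromℕ< 1+s<n) (ℕₚ.+-comm 1 (toℕ s))) , inj₁ (Finₚ.toℕ-fromℕ< 1+s<n)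
    ... | no 1+s≮n =
      fromℕ< 0<n , inj₂ (trans (cong (_+ n) (Finₚ.toℕ-fromℕ< 0<n)) (trans (sym 1+s≡n) (ℕₚ.+-comm 1 (toℕ s)))) ,
      inj₂ (1+s≡n , Finₚ.toℕ-fromℕ< 0<n)
      where
      0<n : 0 < n
      0<n = ℕₚ.≤-<-trans z≤n (Finₚ.toℕ<n s)
      1+s≡n : suc (toℕ s) ≡ n
      1+s≡n = ℕₚ.≤-antisym (Finₚ.toℕ<n s) (ℕₚ.≮⇒≥ 1+s≮n)

    next : Fin n
    next = proj₁ next-exists
    next-at-1 : ArcPosition 1 next
    next-at-1 = proj₁ (proj₂ next-exists)
    s→next : CyclicSucc n (toℕ s) (toℕ next)
    s→next = proj₂ (proj₂ next-exists)

    c[s]≢c[next] : lookup c s ≢ lookup c next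
    c[s]≢c[next] e =
      cyclic-succ-irrefl 2≤n (subst (CyclicSucc n (toℕ s)) (cong toℕ (sym (lookup-injective lin-c _ _ e))) s→next)

    first-two-positions : lookup c s ≡ x ⊎ lookup c s ≡ y → lookup c next ≡ x ⊎ lookup c next ≡ y →
      Neighbours c x y
    first-two-positions (inj₁ c[s]≡x) (inj₂ c[next]≡y) = neighbours s next s→next (inj₁ (sym c[s]≡x , sym c[next]≡y))
    first-two-positions (inj₂ c[s]≡y) (inj₁ c[next]≡x) = neighbours s next s→next (inj₂ (sym c[next]≡x , sym c[s]≡y))
    first-two-positions (inj₁ c[s]≡x) (inj₁ c[next]≡x) = ⊥-elim (c[s]≢c[next] (trans c[s]≡x (sym c[next]≡x)))
    first-two-positions (inj₂ c[s]≡y) (inj₂ c[next]≡y) = ⊥-elim (c[s]≢c[next] (trans c[s]≡y (sym c[next]≡y)))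

top-two-neighbours : ∀ {k} {c v : Order (3 + k)} → Linear c → Linear v →
  IsArc c (λ b → Prefers v b (lookup v 2F)) → Neighbours c (lookup v 0F) (lookup v 1F)
top-two-neighbours {v = v} lin-c lin-v arc =
  two-element-arc lin-c (s≤s (s≤s z≤n)) (λ e → 0≢1 (lookup-injective lin-v _ _ e)) arc above-third
    (prefers-lookup v {0F} {2F} z<s) (prefers-lookup v {1F} {2F} (s<s z<s))
  where
  0≢1 : 0F ≢ 1F
  0≢1 ()
  above-third : ∀ {b} → Prefers v b (lookup v 2F) → b ≡ lookup v 0F ⊎ b ≡ lookup v 1F
  above-third (i , j , i<j , b≡ , v[j]≡v[2]) with lookup-injective lin-v j 2F v[j]≡v[2]
  above-third (0F , _ , _ , refl , _) | refl = inj₁ refl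
  above-third (1F , _ , _ , refl , _) | refl = inj₂ refl
  above-third (Fin.suc (Fin.suc _) , _ , s<s (s<s ()) , _ , _) | refl

-- The top pair along a maximal chain

swap-fixes-top : ∀ {n} {r r′ : Fin (suc n)} {v : Order (suc n)} → Adjacent r r′ → r ≢ 0F →
  lookup (swap r r′ v) 0F ≡ lookup v 0F
swap-fixes-top {r = r} {r′} {v} r⋖r′ r≢0 =
  lookup-swap-other {p = r} {r′} {v} (r≢0 ∘ sym) λ 0≡r′ → ℕₚ.0≢1+n (trans (cong toℕ 0≡r′) r⋖r′)

second-pair : ∀ {n} {p p′ : Fin (3 + n)} → Adjacent p p′ → toℕ p ≡ 1 → p ≡ 1F × p′ ≡ 2F
second-pair {p = 1F} {2F} _ _ = refl , refl
second-pair {p = 1F} {0F} () _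
second-pair {p = 1F} {1F} () _
second-pair {p = 1F} {Fin.suc (Fin.suc (Fin.suc _))} () _
second-pair {p = 0F} _ ()
second-pair {p = Fin.suc (Fin.suc _)} _ ()

above-top-two : ∀ {n} {u : Order (2 + n)} → Linear u → ∀ {a b} →
  lookup u 0F ≡ a ⊎ lookup u 1F ≡ a → Prefers u b a → b ≡ lookup u 0F
above-top-two {u = u} lin-u top-two (i , j , i<j , refl , refl) = at-position top-two
  where
  at-position : lookup u 0F ≡ lookup u j ⊎ lookup u 1F ≡ lookup u j → lookup u i ≡ lookup u 0F
  at-position (inj₁ e) with lookup-injective lin-u _ _ e
  ... | refl = ⊥-elim (ℕₚ.n≮0 i<j)
  at-position (inj₂ e) with lookup-injective lin-u _ _ e
  ... | refl = cong (lookup u) (Finₚ.toℕ-injective (ℕₚ.n<1⇒n≡0 i<j))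

module NotSinglePeakedOnCircle {k} {D : Domain (4 + k)} (chain : SingleCrossingChain D) (maximal : IsMaximalCondorcet D)
  {c : Order (4 + k)} (lin-c : Linear c) (arcs : ∀ v → v ∈ D → ∀ a → IsArc c (λ b → Prefers v b a)) where

  open SingleCrossingChain chain
  open MaximalChain chain maximal

  private
    lin : AllLinear f m
    lin = linear-at

    at : ∀ {u v : Order (4 + k)} → u ≡ v → ∀ i → lookup u i ≡ lookup v i
    at u≡v i = cong (λ w → lookup w i) u≡v

  top-neighbours : ∀ {i} → i < m → Neighbours c (lookup (f i) 0F) (lookup (f i) 1F)
  top-neighbours i<m = top-two-neighbours lin-c (lin i<m) (arcs _ (sound i<m) _)

  SwapsTop : ℕ → Set
  SwapsTop s = f (suc s) ≡ swap 0F 1F (f s)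

  -- With x, y, z the three best alternatives of f s, the top pairs of f s, f (s + 1) and f (s + 3)
  -- are {x, y}, {x, z} and {z, y}.
  top-triangle : ∀ {s} → suc (suc (suc s)) < m → f (suc s) ≡ swap 1F 2F (f s) → SwapsTop (suc s) →
    f (suc (suc (suc s))) ≡ swap 1F 2F (f (suc (suc s))) → ⊥
  top-triangle {s} 3+s<m before swaps after =
    no-neighbour-triangle lin-c (s≤s (s≤s (s≤s (s≤s z≤n)))) (x≢ λ ()) (x≢ λ ()) (x≢ λ ())
      (top-neighbours s<m)
      (subst₂ (Neighbours c) f[1+s][0] f[1+s][1] (top-neighbours 1+s<m))
      (neighbours-sym (subst₂ (Neighbours c) f[3+s][0] f[3+s][1] (top-neighbours 3+s<m)))
    where
    2+s<m : suc (suc s) < m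
    2+s<m = ℕₚ.<-trans (ℕₚ.n<1+n _) 3+s<m
    1+s<m : suc s < m
    1+s<m = ℕₚ.<-trans (ℕₚ.n<1+n _) 2+s<m
    s<m : s < m
    s<m = ℕₚ.<-trans (ℕₚ.n<1+n _) 1+s<m
    x≢ : ∀ {i j} → i ≢ j → lookup (f s) i ≢ lookup (f s) j
    x≢ i≢j = i≢j ∘ lookup-injective (lin s<m) _ _
    f[1+s][0] : lookup (f (suc s)) 0F ≡ lookup (f s) 0F
    f[1+s][0] = trans (at before _) (lookup-swap-other {p = 1F} {2F} {f s} {0F} (λ ()) (λ ()))
    f[1+s][1] : lookup (f (suc s)) 1F ≡ lookup (f s) 2F
    f[1+s][1] = trans (at before _) (lookup-swapˡ {p = 1F} {2F} {f s})
    f[2+s][2] : lookup (f (suc (suc s))) 2F ≡ lookup (f s) 1F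
    f[2+s][2] = trans (at swaps _) (trans (lookup-swap-other {p = 0F} {1F} {f (suc s)} {2F} (λ ()) (λ ()))
                                          (trans (at before _) (lookup-swapʳ {p = 1F} {2F} {f s})))
    f[3+s][0] : lookup (f (suc (suc (suc s)))) 0F ≡ lookup (f s) 2F
    f[3+s][0] = trans (at after _) (trans (lookup-swap-other {p = 1F} {2F} {f (suc (suc s))} {0F} (λ ()) (λ ()))
                                          (trans (at swaps _) (trans (lookup-swapˡ {p = 0F} {1F} {f (suc s)}) f[1+s][1])))
    f[3+s][1] : lookup (f (suc (suc (suc s)))) 1F ≡ lookup (f s) 1F
    f[3+s][1] = trans (at after _) (trans (lookup-swapˡ {p = 1F} {2F} {f (suc (suc s))}) f[2+s][2])

  -- The transpositions just before and after an interior swap of the top pair overlap it, so both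
  -- swap positions 1 and 2.
  interior-top-swap-impossible : ∀ {s} → 1 ≤ s → suc (suc s) < m → SwapsTop s → ⊥
  interior-top-swap-impossible {suc s} _ 3+s<m swaps =
    from-steps (step-is-adjacent-swap 1+s<m) (step-is-adjacent-swap 3+s<m)
    where
    2+s<m : suc (suc s) < m
    2+s<m = ℕₚ.<-trans (ℕₚ.n<1+n _) 3+s<m
    1+s<m : suc s < m
    1+s<m = ℕₚ.<-trans (ℕₚ.n<1+n _) 2+s<m
    from-overlaps : ∀ {p p′ q q′} → Adjacent p p′ → f (suc s) ≡ swap p p′ (f s) →
      Adjacent q q′ → f (suc (suc (suc s))) ≡ swap q q′ (f (suc (suc s))) →
      0 ≡ suc (toℕ p) ⊎ toℕ p ≡ 1 → toℕ q ≡ 1 ⊎ 0 ≡ suc (toℕ q) → ⊥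
    from-overlaps p⋖p′ before q⋖q′ after (inj₂ p≡1) (inj₁ q≡1) =
      triangle (second-pair p⋖p′ p≡1) (second-pair q⋖q′ q≡1) before after
      where
      triangle : ∀ {p p′ q q′} → p ≡ 1F × p′ ≡ 2F → q ≡ 1F × q′ ≡ 2F → f (suc s) ≡ swap p p′ (f s) →
        f (suc (suc (suc s))) ≡ swap q q′ (f (suc (suc s))) → ⊥
      triangle (refl , refl) (refl , refl) before after = top-triangle 3+s<m before swaps after
    from-steps : ∃[ p ] ∃[ p′ ] (Adjacent p p′ × f (suc s) ≡ swap p p′ (f s)) →
      ∃[ q ] ∃[ q′ ] (Adjacent q q′ × f (suc (suc (suc s))) ≡ swap q q′ (f (suc (suc s)))) → ⊥
    from-steps (_ , _ , p⋖p′ , before) (_ , _ , q⋖q′ , after) =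
      from-overlaps p⋖p′ before q⋖q′ after
        (consecutive-swaps-overlap 2+s<m p⋖p′ refl before swaps) (consecutive-swaps-overlap 3+s<m refl q⋖q′ swaps after)

  top-step : ∀ {j} → suc j < m → lookup (f (suc j)) 0F ≡ lookup (f j) 0F ⊎ SwapsTop j
  top-step {j} 1+j<m = classify (step-is-adjacent-swap 1+j<m)
    where
    classify : ∃[ r ] ∃[ r′ ] (Adjacent r r′ × f (suc j) ≡ swap r r′ (f j)) →
      lookup (f (suc j)) 0F ≡ lookup (f j) 0F ⊎ SwapsTop j
    classify (0F , 1F , _ , step) = inj₂ step
    classify (Fin.suc r , r′ , r⋖r′ , step) = inj₁ (trans (at step 0F) (swap-fixes-top {v = f j} r⋖r′ λ ()))

  Early : Fin (4 + k) → Set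
  Early a = a ≡ lookup (f 0) 0F ⊎ a ≡ lookup (f 0) 1F

  module _ (no-interior-top-swap : ∀ {s} → 1 ≤ s → suc (suc s) < m → ¬ SwapsTop s) where

    top-stays-early : ∀ {j} → suc j < m → Early (lookup (f j) 0F)
    top-stays-early {zero} _ = inj₁ refl
    top-stays-early {suc j} 2+j<m = after-step j 2+j<m (top-step 1+j<m)
      where
      1+j<m : suc j < m
      1+j<m = ℕₚ.<-trans (ℕₚ.n<1+n _) 2+j<m
      after-step : ∀ j → suc (suc j) < m → lookup (f (suc j)) 0F ≡ lookup (f j) 0F ⊎ SwapsTop j →
        Early (lookup (f (suc j)) 0F)
      after-step j 2+j<m (inj₁ top-kept) = subst Early (sym top-kept) (top-stays-early (ℕₚ.<-trans (ℕₚ.n<1+n _) 2+j<m))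
      after-step zero _ (inj₂ swaps) = inj₂ (trans (at swaps 0F) (lookup-swapˡ {p = 0F} {1F} {f 0}))
      after-step (suc _) 3+j<m (inj₂ swaps) = ⊥-elim (no-interior-top-swap (s≤s z≤n) 3+j<m swaps)

    early-in-top-two : ∀ {j} → j < m → Early (lookup (f j) 0F) ⊎ Early (lookup (f j) 1F)
    early-in-top-two {zero} _ = inj₁ (inj₁ refl)
    early-in-top-two {suc j} 1+j<m = after-step (top-step 1+j<m)
      where
      after-step : lookup (f (suc j)) 0F ≡ lookup (f j) 0F ⊎ SwapsTop j →
        Early (lookup (f (suc j)) 0F) ⊎ Early (lookup (f (suc j)) 1F)
      after-step (inj₁ top-kept) = inj₁ (subst Early (sym top-kept) (top-stays-early 1+j<m))
      after-step (inj₂ swaps) =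
        inj₂ (subst Early (sym (trans (at swaps 1F) (lookup-swapʳ {p = 0F} {1F} {f j}))) (top-stays-early 1+j<m))

  -- f last reverses f 0, so an early alternative is beaten in f last by two others, which is impossible
  -- for an alternative among the top two.
  beaten-twice : ∀ {i j j′ : Fin (4 + k)} → toℕ i < toℕ j → toℕ j < toℕ j′ →
    ¬ (lookup (f last) 0F ≡ lookup (f 0) i ⊎ lookup (f last) 1F ≡ lookup (f 0) i)
  beaten-twice {i} i<j j<j′ top-two =
    ℕₚ.<⇒≢ j<j′ (cong toℕ (lookup-injective (lin nonempty) _ _
                           (trans (beaten i<j) (sym (beaten (ℕₚ.<-trans i<j j<j′))))))
    where
    beaten : ∀ {j} → toℕ i < toℕ j → lookup (f 0) j ≡ lookup (f last) 0F
    beaten i<j = above-top-two (lin last<m) top-two (ends-reversed (prefers-lookup (f 0) i<j))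

  early-not-in-last-top-two : ∀ {a} → Early a → ¬ (lookup (f last) 0F ≡ a ⊎ lookup (f last) 1F ≡ a)
  early-not-in-last-top-two (inj₁ refl) = beaten-twice {0F} {1F} {2F} z<s (s<s z<s)
  early-not-in-last-top-two (inj₂ refl) = beaten-twice {1F} {2F} {3F} (s<s z<s) (s<s (s<s z<s))

  interior-top-swap : ∃[ s ] (1 ≤ s × suc (suc s) < m × SwapsTop s)
  interior-top-swap = from-search (Finₚ.any? {n = m} λ s →
    (1 ≤? toℕ s) ×-dec (suc (suc (toℕ s)) <? m) ×-dec Vecₚ.≡-dec Finₚ._≟_ (f (suc (toℕ s))) (swap 0F 1F (f (toℕ s))))
    where
    from-search : Dec (∃[ s ] (1 ≤ toℕ s × suc (suc (toℕ s)) < m × SwapsTop (toℕ s))) →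
      ∃[ s ] (1 ≤ s × suc (suc s) < m × SwapsTop s)
    from-search (yes (s , found)) = toℕ s , found
    from-search (no none) = ⊥-elim ([ (λ early → early-not-in-last-top-two early (inj₁ refl))
                                    , (λ early → early-not-in-last-top-two early (inj₂ refl)) ]
                                    (early-in-top-two no-interior-top-swap last<m))
      where
      no-interior-top-swap : ∀ {s} → 1 ≤ s → suc (suc s) < m → ¬ SwapsTop s
      no-interior-top-swap {s} 1≤s 2+s<m swaps =
        let s<m = ℕₚ.<-trans (ℕₚ.n<1+n s) (ℕₚ.<-trans (ℕₚ.n<1+n (suc s)) 2+s<m)
        in none (fromℕ< s<m , subst (λ s → 1 ≤ s × suc (suc s) < m × SwapsTop s) (sym (Finₚ.toℕ-fromℕ< s<m))
                                    (1≤s , 2+s<m , swaps))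

  impossible : ⊥
  impossible = let s , 1≤s , 2+s<m , swaps = interior-top-swap in interior-top-swap-impossible 1≤s 2+s<m swaps

theorem4 : (n : ℕ) → 4 ≤ n → (D : Domain n) →
    IsSingleCrossing D → IsMaximalCondorcet D → ¬ IsSinglePeakedOnCircle D
theorem4 _ (s≤s (s≤s (s≤s (s≤s z≤n)))) D single-crossing maximal (c , c-injective , arcs) =
  NotSinglePeakedOnCircle.impossible (single-crossing-chain single-crossing (proj₁ (proj₁ maximal))) maximal
    {c = c} (linear c-injective) arcs
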